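{- Let $k \geq 1$ and let $(H,\Gamma)$ and $(G,\Sigma)$ be signed graphs such that $(H,\Gamma)$ is a subdivision of $(G,\Sigma)$. Then: (1) $l(G,\Sigma)=l(H,\Gamma)$; (2) $(G,\Sigma)$ is $k$-critical if and only if $(H,\Gamma)$ is $k$-critical; (3) $(G,\Sigma)$ is decomposable if and only if $(H,\Gamma)$ is decomposable.
   Context: A signed graph $(G,\Sigma)$ is a finite graph $G$ (loops and multiple edges allowed) with a set $\Sigma\subseteq E(G)$ of negative edges; other edges are positive. A circuit is negative if it has an odd number of edges in $\Sigma$; $(G,\Sigma)$ is balanced if it has no negative circuit. The frustration index $l(G,\Sigma)$ is the minimum size of $E\subseteq E(G)$ with $(G-E,\Sigma-E)$ balanced. For $k\ge1$, $(G,\Sigma)$ is $k$-critical if $l(G,\Sigma)=k$ and $l(G-e,\Sigma-\{e\})<k$ for every edge $e$. A subgraph of $(G,\Sigma)$ is $(H,\Sigma\cap E(H))$ for a subgraph $H$ of $G$. A $k$-critical signed graph is decomposable if for some $n\ge2$ and positive integers $k_1,\dots,k_n$ with sum $k$ it contains pairwise edge-disjoint subgraphs $(H_i,\Sigma_i)$ with $(H_i,\Sigma_i)$ $k_i$-critical. A $t$-multiedge $E_{xy}$ ($t\ge1$) is a set of $t$ edges between vertices $x$ and $y$; it has a sign if all its edges are positive or all are negative. Subdividing a $t$-multiedge $E_{xy}$ that has a sign: from $(G-E_{xy},\Sigma-E_{xy})$ add a new vertex $v$, $t$ positive edges between $v$ and $x$, and $t$ edges between $v$ and $y$ all having the same sign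 as $E_{xy}$. $(H,\Gamma)$ is a subdivision of $(G,\Sigma)$ if it equals $(G,\Sigma)$ or is obtained from it by a finite sequence of multiedge subdivisions. -}

module Defs where

open import Data.Nat using (ℕ; zero; suc; _+_; _≤_; _<_; _<?_)
open import Data.Bool using (Bool; true; false; _xor_)
open import Data.Fin using (Fin; zero; suc; toℕ; fromℕ; fromℕ<; inject₁)
open import Data.Fin.Subset using (Subset; ⊤; ⊥; _∈_; _⊆_; _─_; _-_; _∩_; ∣_∣)
open import Data.List using (List; length; lookup; map; replicate; _++_)
open import Data.List.Relation.Unary.All using (All)
open import Data.List.Relation.Binary.Permutation.Propositional using (_↭_)
open import Data.Product using (Σ; Σ-syntax; ∃; _×_; _,_)
open import Data.Sum using (_⊎_)
open import Relation.Nullary using (¬_; yes; no)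
open import Relation.Binary.PropositionalEquality using (_≡_; _≢_)
open import Function.Definitions using (Injective)

-- A signed graph on vertex set Fin n is a finite list of edges; an edge
-- is (u , v , s) with endpoints u, v (u ≡ v is a loop; repeated entries
-- are parallel edges) and sign s, where  s ≡ true  means "negative"
-- (the edge is in Σ) and  s ≡ false  means "positive".
-- Edges are identified by their position  Fin (length G)  in the list.

Edge : ℕ → Set
Edge n = Fin n × Fin n × Bool

SignedGraph : ℕ → Set
SignedGraph n = List (Edge n)

∥_∥ : ∀ {n} → SignedGraph n → ℕ
∥ G ∥ = length G

EdgeSet : ∀ {n} → SignedGraph n → Set
EdgeSet G = Subset ∥ G ∥

Joins : ∀ {n} (G : SignedGraph n) → Fin ∥ G ∥ → Fin n → Fin n → Set
Joins G e a b with lookup G e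
... | (u , v , _) = (u ≡ a × v ≡ b) ⊎ (u ≡ b × v ≡ a)

sign : ∀ {n} (G : SignedGraph n) → Fin ∥ G ∥ → Bool
sign G e with lookup G e
... | (_ , _ , s) = s

next : ∀ {k} → Fin (suc k) → Fin (suc k)
next {k} i with suc (toℕ i) <? suc k
... | yes p = fromℕ< p
... | no _  = zero

parity : ∀ {k} → (Fin k → Bool) → Bool
parity {zero}  f = false
parity {suc k} f = f zero xor parity (λ i → f (suc i))

-- A circuit of length (suc k) using only edges of S:
-- distinct vertices v₀ … v_k and distinct edges e₀ … e_k, with eᵢ joining
-- vᵢ and v_{i+1 mod (k+1)}.  (Length 1: a loop; length 2: two parallel edges.)
record Circuit {n} (G : SignedGraph n) (S : EdgeSet G) : Set where
  field
    k     : ℕ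
    verts : Fin (suc k) → Fin n
    edges : Fin (suc k) → Fin ∥ G ∥
    verts-inj : Injective _≡_ _≡_ verts
    edges-inj : Injective _≡_ _≡_ edges
    edges-in  : ∀ i → edges i ∈ S
    joins     : ∀ i → Joins G (edges i) (verts i) (verts (next i))

Negative : ∀ {n} {G : SignedGraph n} {S : EdgeSet G} → Circuit G S → Set
Negative {G = G} C = parity (λ i → sign G (Circuit.edges C i)) ≡ true

Balanced : ∀ {n} (G : SignedGraph n) → EdgeSet G → Set
Balanced G S = ¬ (Σ[ C ∈ Circuit G S ] Negative C)

FrustrationIndex : ∀ {n} (G : SignedGraph n) → EdgeSet G → ℕ → Set
FrustrationIndex G S l =
  (Σ[ E ∈ EdgeSet G ] E ⊆ S × ∣ E ∣ ≡ l × Balanced G (S ─ E))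
  × (∀ (F : EdgeSet G) → F ⊆ S → Balanced G (S ─ F) → l ≤ ∣ F ∣)

CriticalOn : ∀ {n} (G : SignedGraph n) → EdgeSet G → ℕ → Set
CriticalOn G S k =
  1 ≤ k × FrustrationIndex G S k
  × (∀ e → e ∈ S → Σ[ l ∈ ℕ ] l < k × FrustrationIndex G (S - e) l)

Critical : ∀ {n} → SignedGraph n → ℕ → Set
Critical G k = CriticalOn G ⊤ k

sumF : ∀ {m} → (Fin m → ℕ) → ℕ
sumF {zero}  f = 0
sumF {suc m} f = f zero + sumF (λ i → f (suc i))

Decomposable : ∀ {n} → SignedGraph n → Set
Decomposable G =
  Σ[ k ∈ ℕ ] Critical G k ×
  (Σ[ r ∈ ℕ ] 2 ≤ r ×
   Σ[ ks ∈ (Fin r → ℕ) ] (∀ i → 1 ≤ ks i) × sumF ks ≡ k ×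
   Σ[ Hs ∈ (Fin r → EdgeSet G) ]
     (∀ i j → i ≢ j → Hs i ∩ Hs j ≡ ⊥) × (∀ i → CriticalOn G (Hs i) (ks i)))

liftEdge : ∀ {n} → Edge n → Edge (suc n)
liftEdge (u , v , s) = inject₁ u , inject₁ v , s

-- H is obtained from G by subdividing a t-multiedge E_xy with sign s:
-- G's edges are (up to order) rest ++ ms, where ms consists of t ≥ 1 edges
-- between x and y, all of sign s; H has the new vertex v = fromℕ n,
-- the edges of rest, t positive edges v–x and t edges v–y of sign s.
SubdivisionStep : ∀ {n} → SignedGraph n → SignedGraph (suc n) → Set
SubdivisionStep {n} G H =
  Σ[ x ∈ Fin n ] Σ[ y ∈ Fin n ] Σ[ s ∈ Bool ]
  Σ[ rest ∈ SignedGraph n ] Σ[ ms ∈ SignedGraph n ]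
    1 ≤ length ms
    × All (λ e → e ≡ (x , y , s) ⊎ e ≡ (y , x , s)) ms
    × G ↭ rest ++ ms
    × H ↭ (map liftEdge rest
           ++ replicate (length ms) (fromℕ n , inject₁ x , false)
           ++ replicate (length ms) (fromℕ n , inject₁ y , s))

data Subdivision : ∀ {n m} → SignedGraph n → SignedGraph m → Set where
  same : ∀ {n} {G : SignedGraph n} → Subdivision G G
  step : ∀ {n m} {G : SignedGraph n} {G′ : SignedGraph (suc n)} {H : SignedGraph m}
         → SubdivisionStep G G′ → Subdivision G′ H → Subdivision G H

{-# OPTIONS --safe #-}
-- Subdividing a t-multiedge x–y of sign s into t positive edges v–x and t edges v–y of sign s
-- (v a new vertex) turns negative circuits into negative circuits both ways. A negative circuit
-- uses at most one edge of a multiedge, since two parallel edges of equal sign form a positive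
-- digon; so it either avoids the multiedge, or it uses one x–y edge, which is replaced by a path
-- x–v–y of the same total sign. Conversely a negative circuit through v uses one v–x and one
-- v–y edge. Hence, writing edge sets of G and H as R ∪ Z and R ∪ X ∪ Y (Z inside the
-- multiedge, X and Y inside its two halves), the two are balanced together whenever Z is
-- nonempty exactly when both X and Y are. A balancing set either leaves part of Z, or deletes all of it, which
-- costs as much as deleting the smaller half; so the frustration indices agree whenever
-- |Z| = min(|X|, |Y|). Deleting a single edge preserves this relation, which transfers
-- criticality, and in a critical subgraph of H both halves have equal size, which transfers
-- decompositions back. All notions are invariant under relabelling edges, and the theorem
-- follows by induction on the number of subdivision steps.
module Submission where

open import Defs
open import Data.Nat using (ℕ; zero; suc; _+_; _≤_; _<_; _<?_; _⊓_; z≤n; s≤s)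
open import Data.Nat.Properties as ℕ using ()
open import Data.Bool using (Bool; true; false; _xor_)
open import Data.Bool.Properties using (xor-comm; xor-assoc; xor-identityʳ)
open import Data.Fin using (Fin; zero; suc; toℕ; fromℕ; inject₁; lower₁; _↑ˡ_; _↑ʳ_; splitAt; join)
open import Data.Fin.Properties as Fin using (toℕ-injective; toℕ-fromℕ; toℕ-inject₁; toℕ-fromℕ<; fromℕ≢inject₁; inject₁-injective)
open import Data.Fin.Subset using (Subset; ⊤; ⊥; _∈_; _∉_; _⊆_; _─_; _-_; _∩_; ∣_∣; ⁅_⁆; Nonempty; Empty)
open import Data.Fin.Subset.Properties
  using (⊆-refl; ⊆-antisym; ⊥⊆; _∈?_; ∉⊥; x∈⁅x⁆; x∈⁅y⁆⇒x≡y; x∈p∩q⁺; x∈p∩q⁻; x∈p∧x∉q⇒x∈p─q; p─⊥≡p; p─q⊆p;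
         nonempty?; Empty-unique; ∣⊥∣≡0; p⊆q⇒∣p∣≤∣q∣)
open import Data.Vec as Vec using ([]; _∷_; lookup; _++_; replicate; tabulate)
open import Data.Vec.Properties
  using (++-injective; []=⇒lookup; lookup⇒[]=; lookup-++ˡ; lookup-++ʳ; zipWith-++; lookup∘tabulate; tabulate∘lookup;
         tabulate-cong; lookup-replicate)
open import Data.Fin.Permutation as Perm using (Permutation; _⟨$⟩ʳ_; _⟨$⟩ˡ_; inverseˡ; inverseʳ)
open import Algebra.Properties.CommutativeMonoid.Sum ℕ.+-0-commutativeMonoid using (sum; sum-cong-≗; ∑-permute)
open import Data.Product using (Σ; Σ-syntax; _×_; _,_; proj₁; proj₂; uncurry)
open import Data.Sum as Sum using (_⊎_; inj₁; inj₂; [_,_]′)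
import Data.List as List
open import Data.List.Properties using (length-replicate)
open import Data.List.Relation.Unary.All using (All; []; _∷_)
open import Data.List.Relation.Binary.Permutation.Propositional using (_↭_; ↭⇒↭ₛ)
import Data.List.Relation.Binary.Permutation.Setoid as PermutationSetoid
import Data.List.Relation.Binary.Permutation.Setoid.Properties as PermutationSetoidProperties
open import Data.Vec.Functional using () renaming (_++_ to _++ᶠ_)
open import Data.Vec.Functional.Properties using () renaming (lookup-++ˡ to lookup-++ᶠˡ; lookup-++ʳ to lookup-++ᶠʳ)
open import Data.Sum.Function.Propositional using (_⊎-↔_)
open import Function.Properties.Inverse using (↔-sym; ↔-trans)
open import Data.Empty using (⊥-elim)
open import Relation.Nullary using (¬_; yes; no)
open import Relation.Binary.Definitions using (tri<; tri≈; tri>)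
open import Relation.Binary.PropositionalEquality
open import Function using (_∘_)
open import Function.Bundles using (_⇔_; mk⇔)
open import Function.Construct.Identity using (⇔-id)
open import Function.Construct.Symmetry using (⇔-sym)
open import Function.Construct.Composition using (_⇔-∘_)
open import Function.Definitions using (Injective)

-- Cyclic sequences

next-< : ∀ {k} (i : Fin (suc k)) → suc (toℕ i) < suc k → toℕ (next i) ≡ suc (toℕ i)
next-< {k} i p with suc (toℕ i) <? suc k
... | yes q = toℕ-fromℕ< q
... | no ¬q = ⊥-elim (¬q p)

next-inject₁ : ∀ {k} (j : Fin k) → next (inject₁ j) ≡ suc j
next-inject₁ {k} j = toℕ-injective (trans (next-< (inject₁ j) lt) (cong suc (toℕ-inject₁ j)))
  where
  lt : suc (toℕ (inject₁ j)) < suc k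
  lt = s≤s (subst (λ z → suc z ≤ k) (sym (toℕ-inject₁ j)) (Fin.toℕ<n j))

next-fromℕ : ∀ k → next (fromℕ k) ≡ zero
next-fromℕ k with suc (toℕ (fromℕ k)) <? suc k
... | yes p = ⊥-elim (ℕ.<-irrefl (toℕ-fromℕ k) (ℕ.≤-pred p))
... | no _  = refl

data InjectOrLast {k : ℕ} : Fin (suc k) → Set where
  inject₁-view : (j : Fin k) → InjectOrLast (inject₁ j)
  fromℕ-view   : InjectOrLast (fromℕ k)

injectOrLast : ∀ {k} (i : Fin (suc k)) → InjectOrLast i
injectOrLast {zero}  zero    = fromℕ-view
injectOrLast {suc k} zero    = inject₁-view zero
injectOrLast {suc k} (suc i) with injectOrLast i
... | inject₁-view j = inject₁-view (suc j)
... | fromℕ-view     = fromℕ-view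

next-injective : ∀ {k} → Injective _≡_ _≡_ (next {k})
next-injective {k} {i} {j} eq with injectOrLast i | injectOrLast j
... | inject₁-view a | inject₁-view b =
  cong inject₁ (Fin.suc-injective (trans (sym (next-inject₁ a)) (trans eq (next-inject₁ b))))
... | inject₁-view a | fromℕ-view =
  ⊥-elim (Fin.0≢1+n (sym (trans (sym (next-inject₁ a)) (trans eq (next-fromℕ k)))))
... | fromℕ-view | inject₁-view b =
  ⊥-elim (Fin.0≢1+n (sym (trans (sym (next-inject₁ b)) (trans (sym eq) (next-fromℕ k)))))
... | fromℕ-view | fromℕ-view = refl

next²≡id⇒k≡1 : ∀ {k} (i : Fin (suc k)) → next (next i) ≡ i → next i ≢ i → k ≡ 1
next²≡id⇒k≡1 {zero}        zero _  ne = ⊥-elim (ne refl)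
next²≡id⇒k≡1 {suc zero}    i    _  _  = refl
next²≡id⇒k≡1 {suc (suc k)} i    eq _  with injectOrLast i
... | fromℕ-view = ⊥-elim (suc≢fromℕ (trans (sym (next-inject₁ zero))
                                     (trans (sym (cong next (next-fromℕ (suc (suc k))))) eq)))
  where
  suc≢fromℕ : suc zero ≢ fromℕ (suc (suc k))
  suc≢fromℕ ()
... | inject₁-view j with injectOrLast j
...   | inject₁-view j′ = ⊥-elim (ℕ.<-irrefl (sym toℕ≡) (ℕ.m≤n⇒m≤1+n ℕ.≤-refl))
  where
  toℕ≡ : suc (suc (toℕ j′)) ≡ toℕ j′
  toℕ≡ = trans (cong toℕ (trans (sym (trans (cong next (next-inject₁ (inject₁ j′))) (next-inject₁ (suc j′)))) eq))
               (trans (toℕ-inject₁ (inject₁ j′)) (toℕ-inject₁ j′))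
...   | fromℕ-view = ⊥-elim (zero≢ (trans (sym (trans (cong next (next-inject₁ (fromℕ (suc k)))) (next-fromℕ (suc (suc k))))) eq))
  where
  zero≢ : zero ≢ inject₁ (fromℕ (suc k))
  zero≢ ()

true≢false : true ≢ false
true≢false ()

parity-cong : ∀ {k} {f g : Fin k → Bool} → (∀ i → f i ≡ g i) → parity f ≡ parity g
parity-cong {zero}  p = refl
parity-cong {suc k} p = cong₂ _xor_ (p zero) (parity-cong (p ∘ suc))

parity-init-last : ∀ {k} (f : Fin (suc k) → Bool) → parity f ≡ parity (f ∘ inject₁) xor f (fromℕ k)
parity-init-last {zero} f with f zero
... | true  = refl
... | false = refl
parity-init-last {suc k} f =
  trans (cong (f zero xor_) (parity-init-last (f ∘ suc))) (sym (xor-assoc (f zero) _ _))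

parity-∘next : ∀ {k} (f : Fin (suc k) → Bool) → parity (f ∘ next) ≡ parity f
parity-∘next {k} f = begin
  parity (f ∘ next)                                  ≡⟨ parity-init-last (f ∘ next) ⟩
  parity (f ∘ next ∘ inject₁) xor f (next (fromℕ k)) ≡⟨ cong₂ _xor_ (parity-cong (cong f ∘ next-inject₁))
                                                                     (cong f (next-fromℕ k)) ⟩
  parity (f ∘ suc) xor f zero                        ≡⟨ xor-comm (parity (f ∘ suc)) (f zero) ⟩
  parity f                                           ∎
  where open ≡-Reasoning

snoc : ∀ {k} {A : Set} → (Fin k → A) → A → Fin (suc k) → A
snoc {zero}  f a zero    = a
snoc {suc k} f a zero    = f zero
snoc {suc k} f a (suc i) = snoc (f ∘ suc) a i

snoc-inject₁ : ∀ {k} {A : Set} (f : Fin k → A) a j → snoc f a (inject₁ j) ≡ f j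
snoc-inject₁ {suc k} f a zero    = refl
snoc-inject₁ {suc k} f a (suc j) = snoc-inject₁ (f ∘ suc) a j

snoc-fromℕ : ∀ {k} {A : Set} (f : Fin k → A) a → snoc f a (fromℕ k) ≡ a
snoc-fromℕ {zero}  f a = refl
snoc-fromℕ {suc k} f a = snoc-fromℕ (f ∘ suc) a

snoc-all : ∀ {k} {A : Set} (P : A → Set) {f : Fin k → A} {a} → (∀ j → P (f j)) → P a → ∀ i → P (snoc f a i)
snoc-all P {f} {a} pf pa i with injectOrLast i
... | inject₁-view j = subst P (sym (snoc-inject₁ f a j)) (pf j)
... | fromℕ-view     = subst P (sym (snoc-fromℕ f a)) pa

snoc-injective : ∀ {k} {A : Set} {f : Fin k → A} {a} →
  Injective _≡_ _≡_ f → (∀ j → f j ≢ a) → Injective _≡_ _≡_ (snoc f a)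
snoc-injective {f = f} {a} f-inj f≢a {i} {j} eq with injectOrLast i | injectOrLast j
... | inject₁-view b | inject₁-view c =
  cong inject₁ (f-inj (trans (sym (snoc-inject₁ f a b)) (trans eq (snoc-inject₁ f a c))))
... | inject₁-view b | fromℕ-view = ⊥-elim (f≢a b (trans (sym (snoc-inject₁ f a b)) (trans eq (snoc-fromℕ f a))))
... | fromℕ-view | inject₁-view c = ⊥-elim (f≢a c (trans (sym (snoc-inject₁ f a c)) (trans (sym eq) (snoc-fromℕ f a))))
... | fromℕ-view | fromℕ-view = refl

∘-snoc : ∀ {k} {A B : Set} (F : A → B) (f : Fin k → A) a i → F (snoc f a i) ≡ snoc (F ∘ f) (F a) i
∘-snoc {zero}  F f a zero    = refl
∘-snoc {suc k} F f a zero    = refl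
∘-snoc {suc k} F f a (suc i) = ∘-snoc F (f ∘ suc) a i

parity-snoc : ∀ {k} (f : Fin k → Bool) a → parity (snoc f a) ≡ parity f xor a
parity-snoc {k} f a = trans (parity-init-last (snoc f a))
  (cong₂ _xor_ (parity-cong (snoc-inject₁ f a)) (snoc-fromℕ f a))

next^ : ∀ {k} → ℕ → Fin (suc k) → Fin (suc k)
next^ zero    i = i
next^ (suc c) i = next^ c (next i)

next^-next : ∀ {k} c (i : Fin (suc k)) → next^ c (next i) ≡ next (next^ c i)
next^-next zero    i = refl
next^-next (suc c) i = next^-next c (next i)

next^-injective : ∀ {k} c → Injective _≡_ _≡_ (next^ {k} c)
next^-injective zero    eq = eq
next^-injective (suc c) eq = next-injective (next^-injective c eq)

parity-∘next^ : ∀ {k} c (f : Fin (suc k) → Bool) → parity (f ∘ next^ c) ≡ parity f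
parity-∘next^ zero    f = refl
parity-∘next^ (suc c) f = trans (parity-∘next (f ∘ next^ c)) (parity-∘next^ c f)

toℕ-next^-zero : ∀ {k} c → c < suc k → toℕ (next^ {k} c zero) ≡ c
toℕ-next^-zero zero    _ = refl
toℕ-next^-zero {k} (suc c) c<k = begin
  toℕ (next^ c (next zero)) ≡⟨ cong toℕ (next^-next c zero) ⟩
  toℕ (next (next^ c zero)) ≡⟨ next-< (next^ c zero) (subst (λ z → suc z < suc k) (sym ih) c<k) ⟩
  suc (toℕ (next^ c zero))  ≡⟨ cong suc ih ⟩
  suc c                     ∎
  where
  open ≡-Reasoning
  ih : toℕ (next^ {k} c zero) ≡ c
  ih = toℕ-next^-zero c (ℕ.<-trans (ℕ.n<1+n c) c<k)

next^-fromℕ : ∀ {k} (p : Fin (suc k)) → next^ (suc (toℕ p)) (fromℕ k) ≡ p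
next^-fromℕ {k} p =
  trans (cong (next^ (toℕ p)) (next-fromℕ k)) (toℕ-injective (toℕ-next^-zero (toℕ p) (Fin.toℕ<n p)))

-- Subsets of a disjoint union

data ↑View (m n : ℕ) : Fin (m + n) → Set where
  ↑ˡ-view : (i : Fin m) → ↑View m n (i ↑ˡ n)
  ↑ʳ-view : (j : Fin n) → ↑View m n (m ↑ʳ j)

↑view : ∀ m n (e : Fin (m + n)) → ↑View m n e
↑view m n e with splitAt m e in eq
... | inj₁ i = subst (↑View m n) (Fin.splitAt⁻¹-↑ˡ eq) (↑ˡ-view i)
... | inj₂ j = subst (↑View m n) (Fin.splitAt⁻¹-↑ʳ eq) (↑ʳ-view j)

↑ˡ≢↑ʳ : ∀ {m n} (i : Fin m) (j : Fin n) → i ↑ˡ n ≢ m ↑ʳ j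
↑ˡ≢↑ʳ {m} {n} i j eq with trans (sym (Fin.splitAt-↑ˡ m i n)) (trans (cong (splitAt m) eq) (Fin.splitAt-↑ʳ m n j))
... | ()

module _ {m n} {p : Subset m} {q : Subset n} where

  ∈-++⁺ˡ : ∀ {i} → i ∈ p → i ↑ˡ n ∈ p ++ q
  ∈-++⁺ˡ {i} i∈p = lookup⇒[]= _ (p ++ q) (trans (lookup-++ˡ p q i) ([]=⇒lookup i∈p))

  ∈-++⁺ʳ : ∀ {j} → j ∈ q → m ↑ʳ j ∈ p ++ q
  ∈-++⁺ʳ {j} j∈q = lookup⇒[]= _ (p ++ q) (trans (lookup-++ʳ p q j) ([]=⇒lookup j∈q))

  ∈-++⁻ˡ : ∀ {i} → i ↑ˡ n ∈ p ++ q → i ∈ p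
  ∈-++⁻ˡ {i} i∈ = lookup⇒[]= i p (trans (sym (lookup-++ˡ p q i)) ([]=⇒lookup i∈))

  ∈-++⁻ʳ : ∀ {j} → m ↑ʳ j ∈ p ++ q → j ∈ q
  ∈-++⁻ʳ {j} j∈ = lookup⇒[]= j q (trans (sym (lookup-++ʳ p q j)) ([]=⇒lookup j∈))

module _ {m n} {p p′ : Subset m} {q q′ : Subset n} where

  ++⁺-⊆ : p ⊆ p′ → q ⊆ q′ → p ++ q ⊆ p′ ++ q′
  ++⁺-⊆ p⊆ q⊆ {e} e∈ with ↑view m n e
  ... | ↑ˡ-view i = ∈-++⁺ˡ (p⊆ (∈-++⁻ˡ e∈))
  ... | ↑ʳ-view j = ∈-++⁺ʳ (q⊆ (∈-++⁻ʳ e∈))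

  ++⁻ˡ-⊆ : p ++ q ⊆ p′ ++ q′ → p ⊆ p′
  ++⁻ˡ-⊆ ⊆′ i∈ = ∈-++⁻ˡ {q = q′} (⊆′ (∈-++⁺ˡ i∈))

∣++∣ : ∀ {m n} (p : Subset m) (q : Subset n) → ∣ p ++ q ∣ ≡ ∣ p ∣ + ∣ q ∣
∣++∣ []           q = refl
∣++∣ (true ∷ p)  q = cong suc (∣++∣ p q)
∣++∣ (false ∷ p) q = ∣++∣ p q

replicate-++ : ∀ {A : Set} m n (a : A) → replicate (m + n) a ≡ replicate m a ++ replicate n a
replicate-++ zero    n a = refl
replicate-++ (suc m) n a = cong (a ∷_) (replicate-++ m n a)

─-++ : ∀ {m n} (p p′ : Subset m) (q q′ : Subset n) → (p ++ q) ─ (p′ ++ q′) ≡ (p ─ p′) ++ (q ─ q′)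
─-++ p p′ q q′ = zipWith-++ _ p q p′ q′

∩-++ : ∀ {m n} (p p′ : Subset m) (q q′ : Subset n) → (p ++ q) ∩ (p′ ++ q′) ≡ (p ∩ p′) ++ (q ∩ q′)
∩-++ p p′ q q′ = zipWith-++ _ p q p′ q′

∣++₃∣ : ∀ {a b c} (p : Subset a) (q : Subset b) (q′ : Subset c) → ∣ p ++ (q ++ q′) ∣ ≡ ∣ p ∣ + (∣ q ∣ + ∣ q′ ∣)
∣++₃∣ p q q′ = trans (∣++∣ p (q ++ q′)) (cong (∣ p ∣ +_) (∣++∣ q q′))

─-++₃ : ∀ {a b c} (p p′ : Subset a) (q w : Subset b) (q′ w′ : Subset c) →
  (p ++ (q ++ q′)) ─ (p′ ++ (w ++ w′)) ≡ (p ─ p′) ++ ((q ─ w) ++ (q′ ─ w′))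
─-++₃ p p′ q w q′ w′ = trans (─-++ p p′ (q ++ q′) (w ++ w′)) (cong ((p ─ p′) ++_) (─-++ q w q′ w′))

⁅↑ˡ⁆ : ∀ {m} n (i : Fin m) → ⁅ i ↑ˡ n ⁆ ≡ ⁅ i ⁆ ++ ⊥ {n}
⁅↑ˡ⁆ {suc m} n zero    = cong (true ∷_) (replicate-++ m n false)
⁅↑ˡ⁆ {suc m} n (suc i) = cong (false ∷_) (⁅↑ˡ⁆ n i)

⁅↑ʳ⁆ : ∀ m {n} (j : Fin n) → ⁅ m ↑ʳ j ⁆ ≡ ⊥ {m} ++ ⁅ j ⁆
⁅↑ʳ⁆ zero    j = refl
⁅↑ʳ⁆ (suc m) j = cong (false ∷_) (⁅↑ʳ⁆ m j)

++--↑ˡ : ∀ {m n} (p : Subset m) (q : Subset n) i → (p ++ q) - (i ↑ˡ n) ≡ (p - i) ++ q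
++--↑ˡ {n = n} p q i = begin
  (p ++ q) ─ ⁅ i ↑ˡ n ⁆     ≡⟨ cong ((p ++ q) ─_) (⁅↑ˡ⁆ n i) ⟩
  (p ++ q) ─ (⁅ i ⁆ ++ ⊥)  ≡⟨ ─-++ p ⁅ i ⁆ q ⊥ ⟩
  (p - i) ++ (q ─ ⊥)       ≡⟨ cong ((p - i) ++_) (p─⊥≡p q) ⟩
  (p - i) ++ q             ∎
  where open ≡-Reasoning

++--↑ʳ : ∀ {m n} (p : Subset m) (q : Subset n) j → (p ++ q) - (m ↑ʳ j) ≡ p ++ (q - j)
++--↑ʳ {m} p q j = begin
  (p ++ q) ─ ⁅ m ↑ʳ j ⁆     ≡⟨ cong ((p ++ q) ─_) (⁅↑ʳ⁆ m j) ⟩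
  (p ++ q) ─ (⊥ ++ ⁅ j ⁆)  ≡⟨ ─-++ p ⊥ q ⁅ j ⁆ ⟩
  (p ─ ⊥) ++ (q - j)       ≡⟨ cong (_++ (q - j)) (p─⊥≡p p) ⟩
  p ++ (q - j)             ∎
  where open ≡-Reasoning

++-disjoint⁺ : ∀ {m n} {p p′ : Subset m} {q q′ : Subset n} →
  p ∩ p′ ≡ ⊥ → q ∩ q′ ≡ ⊥ → (p ++ q) ∩ (p′ ++ q′) ≡ ⊥
++-disjoint⁺ {m} {n} {p} {p′} {q} {q′} p∩p′≡⊥ q∩q′≡⊥ =
  trans (∩-++ p p′ q q′) (trans (cong₂ _++_ p∩p′≡⊥ q∩q′≡⊥) (sym (replicate-++ m n false)))

++-disjoint⁻ : ∀ {m n} (p p′ : Subset m) {q q′ : Subset n} →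
  (p ++ q) ∩ (p′ ++ q′) ≡ ⊥ → p ∩ p′ ≡ ⊥ × q ∩ q′ ≡ ⊥
++-disjoint⁻ {m} {n} p p′ {q} {q′} eq =
  ++-injective (p ∩ p′) ⊥ (trans (sym (∩-++ p p′ q q′)) (trans eq (replicate-++ m n false)))

p─p≡⊥ : ∀ {m} (p : Subset m) → p ─ p ≡ ⊥
p─p≡⊥ []          = refl
p─p≡⊥ (true ∷ p)  = cong (false ∷_) (p─p≡⊥ p)
p─p≡⊥ (false ∷ p) = cong (false ∷_) (p─p≡⊥ p)

Empty-p─p : ∀ {m} (p : Subset m) → Empty (p ─ p)
Empty-p─p p (x , x∈) = ∉⊥ (subst (x ∈_) (p─p≡⊥ p) x∈)

Empty-─⇒⊆ : ∀ {m} {p q : Subset m} → Empty (p ─ q) → p ⊆ q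
Empty-─⇒⊆ {q = q} empty {x} x∈p with x ∈? q
... | yes x∈q = x∈q
... | no  x∉q = ⊥-elim (empty (x , x∈p∧x∉q⇒x∈p─q x∈p x∉q))

1≤∣p∣⇒Nonempty : ∀ {m} (p : Subset m) → 1 ≤ ∣ p ∣ → Nonempty p
1≤∣p∣⇒Nonempty {m} p 1≤∣p∣ with nonempty? p
... | yes ne = ne
... | no  ¬ne = ⊥-elim (ℕ.<-irrefl (sym (trans (cong ∣_∣ (Empty-unique ¬ne)) (∣⊥∣≡0 m))) 1≤∣p∣)

∣p-x∣+1≡∣p∣ : ∀ {m} {p : Subset m} {x} → x ∈ p → suc ∣ p - x ∣ ≡ ∣ p ∣
∣p-x∣+1≡∣p∣ {p = true ∷ p} Vec.here = cong (suc ∘ ∣_∣) (p─⊥≡p p)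
∣p-x∣+1≡∣p∣ {p = true ∷ p}  (Vec.there x∈p) = cong suc (∣p-x∣+1≡∣p∣ x∈p)
∣p-x∣+1≡∣p∣ {p = false ∷ p} (Vec.there x∈p) = ∣p-x∣+1≡∣p∣ x∈p

∣p-x∣≤∣p∣ : ∀ {m} (p : Subset m) x → ∣ p - x ∣ ≤ ∣ p ∣
∣p-x∣≤∣p∣ p x = p⊆q⇒∣p∣≤∣q∣ (p─q⊆p p ⁅ x ⁆)

x∈p─q⇒x∉q : ∀ {m} (p q : Subset m) {x} → x ∈ p ─ q → x ∉ q
x∈p─q⇒x∉q (true ∷ p) (false ∷ q) Vec.here ()
x∈p─q⇒x∉q (_ ∷ p)    (_ ∷ q)     (Vec.there x∈) (Vec.there x∈q) = x∈p─q⇒x∉q p q x∈ x∈q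

-- Relabelling edge indices along a permutation

subset-ext : ∀ {m} {p q : Subset m} → (∀ x → lookup p x ≡ lookup q x) → p ≡ q
subset-ext {p = p} {q} eq = trans (sym (tabulate∘lookup p)) (trans (tabulate-cong eq) (tabulate∘lookup q))

infixr 5 _⟨$⟩ˢ_

_⟨$⟩ˢ_ : ∀ {m m′} → Permutation m m′ → Subset m → Subset m′
π ⟨$⟩ˢ S = tabulate (lookup S ∘ (π ⟨$⟩ˡ_))

indicator : Bool → ℕ
indicator true  = 1
indicator false = 0

∣p∣≡∑indicator : ∀ {m} (p : Subset m) → ∣ p ∣ ≡ sum (indicator ∘ lookup p)
∣p∣≡∑indicator []          = refl
∣p∣≡∑indicator (true ∷ p)  = cong suc (∣p∣≡∑indicator p)
∣p∣≡∑indicator (false ∷ p) = ∣p∣≡∑indicator p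

module _ {m m′} (π : Permutation m m′) where

  lookup-⟨$⟩ˢ : ∀ S x → lookup (π ⟨$⟩ˢ S) x ≡ lookup S (π ⟨$⟩ˡ x)
  lookup-⟨$⟩ˢ S x = lookup∘tabulate _ x

  ∈-⟨$⟩ˢ⁺ : ∀ {S e} → e ∈ S → π ⟨$⟩ʳ e ∈ π ⟨$⟩ˢ S
  ∈-⟨$⟩ˢ⁺ {S} {e} e∈S = lookup⇒[]= _ (π ⟨$⟩ˢ S)
    (trans (lookup-⟨$⟩ˢ S (π ⟨$⟩ʳ e)) (trans (cong (lookup S) (inverseˡ π)) ([]=⇒lookup e∈S)))

  ∈-⟨$⟩ˢ⁻ : ∀ {S x} → x ∈ π ⟨$⟩ˢ S → π ⟨$⟩ˡ x ∈ S
  ∈-⟨$⟩ˢ⁻ {S} {x} x∈ = lookup⇒[]= _ S (trans (sym (lookup-⟨$⟩ˢ S x)) ([]=⇒lookup x∈))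

  ∈-⟨$⟩ˢ⁺′ : ∀ {S x} → π ⟨$⟩ˡ x ∈ S → x ∈ π ⟨$⟩ˢ S
  ∈-⟨$⟩ˢ⁺′ y∈S = subst (_∈ _) (inverseʳ π) (∈-⟨$⟩ˢ⁺ y∈S)

  ⟨$⟩ˢ-⊆ : ∀ {E S} → E ⊆ S → π ⟨$⟩ˢ E ⊆ π ⟨$⟩ˢ S
  ⟨$⟩ˢ-⊆ E⊆S x∈ = ∈-⟨$⟩ˢ⁺′ (E⊆S (∈-⟨$⟩ˢ⁻ x∈))

  ⟨$⟩ˢ-replicate : ∀ b → π ⟨$⟩ˢ replicate m b ≡ replicate m′ b
  ⟨$⟩ˢ-replicate b = subset-ext λ x →
    trans (lookup-⟨$⟩ˢ (replicate m b) x) (trans (lookup-replicate (π ⟨$⟩ˡ x) b) (sym (lookup-replicate x b)))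

  ⟨$⟩ˢ-⁅⁆ : ∀ e → π ⟨$⟩ˢ ⁅ e ⁆ ≡ ⁅ π ⟨$⟩ʳ e ⁆
  ⟨$⟩ˢ-⁅⁆ e = ⊆-antisym
    (λ x∈ → subst (_∈ ⁅ _ ⁆)
       (trans (sym (cong (π ⟨$⟩ʳ_) (x∈⁅y⁆⇒x≡y e (∈-⟨$⟩ˢ⁻ {⁅ e ⁆} x∈)))) (inverseʳ π)) (x∈⁅x⁆ _))
    (λ x∈ → subst (_∈ _) (sym (x∈⁅y⁆⇒x≡y _ x∈)) (∈-⟨$⟩ˢ⁺ (x∈⁅x⁆ e)))

  ⟨$⟩ˢ-─ : ∀ S E → π ⟨$⟩ˢ (S ─ E) ≡ (π ⟨$⟩ˢ S) ─ (π ⟨$⟩ˢ E)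
  ⟨$⟩ˢ-─ S E = ⊆-antisym
    (λ x∈ → let y∈ = ∈-⟨$⟩ˢ⁻ {S ─ E} x∈ in
      x∈p∧x∉q⇒x∈p─q (∈-⟨$⟩ˢ⁺′ (p─q⊆p S E y∈)) (x∈p─q⇒x∉q S E y∈ ∘ ∈-⟨$⟩ˢ⁻ {E}))
    (λ x∈ → ∈-⟨$⟩ˢ⁺′ (x∈p∧x∉q⇒x∈p─q (∈-⟨$⟩ˢ⁻ {S} (p─q⊆p _ _ x∈))
                                      (x∈p─q⇒x∉q _ _ x∈ ∘ ∈-⟨$⟩ˢ⁺′ {E})))

  ⟨$⟩ˢ-∩ : ∀ S E → π ⟨$⟩ˢ (S ∩ E) ≡ (π ⟨$⟩ˢ S) ∩ (π ⟨$⟩ˢ E)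
  ⟨$⟩ˢ-∩ S E = ⊆-antisym
    (λ x∈ → let (y∈S , y∈E) = x∈p∩q⁻ S E (∈-⟨$⟩ˢ⁻ {S ∩ E} x∈)
            in x∈p∩q⁺ (∈-⟨$⟩ˢ⁺′ y∈S , ∈-⟨$⟩ˢ⁺′ y∈E))
    (λ x∈ → let (x∈S , x∈E) = x∈p∩q⁻ _ _ x∈
            in ∈-⟨$⟩ˢ⁺′ (x∈p∩q⁺ (∈-⟨$⟩ˢ⁻ {S} x∈S , ∈-⟨$⟩ˢ⁻ {E} x∈E)))

  ⟨$⟩ˢ-- : ∀ S e → π ⟨$⟩ˢ (S - e) ≡ (π ⟨$⟩ˢ S) - (π ⟨$⟩ʳ e)
  ⟨$⟩ˢ-- S e = trans (⟨$⟩ˢ-─ S ⁅ e ⁆) (cong ((π ⟨$⟩ˢ S) ─_) (⟨$⟩ˢ-⁅⁆ e))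

  flip-⟨$⟩ˢ : ∀ S → Perm.flip π ⟨$⟩ˢ (π ⟨$⟩ˢ S) ≡ S
  flip-⟨$⟩ˢ S = subset-ext λ x → trans (lookup∘tabulate _ x) (trans (lookup-⟨$⟩ˢ S (π ⟨$⟩ʳ x)) (cong (lookup S) (inverseˡ π)))

  ∣⟨$⟩ˢ∣ : ∀ S → ∣ π ⟨$⟩ˢ S ∣ ≡ ∣ S ∣
  ∣⟨$⟩ˢ∣ S = begin
    ∣ π ⟨$⟩ˢ S ∣                                ≡⟨ ∣p∣≡∑indicator (π ⟨$⟩ˢ S) ⟩
    sum (indicator ∘ lookup (π ⟨$⟩ˢ S))         ≡⟨ sum-cong-≗ (cong indicator ∘ lookup-⟨$⟩ˢ S) ⟩
    sum (indicator ∘ lookup S ∘ (π ⟨$⟩ˡ_))      ≡⟨ ∑-permute (indicator ∘ lookup S) (Perm.flip π) ⟨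
    sum (indicator ∘ lookup S)                  ≡⟨ ∣p∣≡∑indicator S ⟨
    ∣ S ∣                                       ∎
    where open ≡-Reasoning

-- Signed graphs with indexed edges

IndexedGraph : ℕ → ℕ → Set
IndexedGraph n m = Fin m → Edge n

Joinsᵉ : ∀ {n} → Edge n → Fin n → Fin n → Set
Joinsᵉ (u , v , _) a b = (u ≡ a × v ≡ b) ⊎ (u ≡ b × v ≡ a)

signᵉ : ∀ {n} → Edge n → Bool
signᵉ (_ , _ , s) = s

infix 4 _≈ᵉ_

_≈ᵉ_ : ∀ {n} → Edge n → Edge n → Set
e ≈ᵉ (u , v , s) = Joinsᵉ e u v × signᵉ e ≡ s

≈ᵉ-refl : ∀ {n} (e : Edge n) → e ≈ᵉ e
≈ᵉ-refl (u , v , s) = inj₁ (refl , refl) , refl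

≈ᵉ-sym : ∀ {n} {e e′ : Edge n} → e ≈ᵉ e′ → e′ ≈ᵉ e
≈ᵉ-sym {e = u , v , s} {u′ , v′ , s′} (inj₁ (refl , refl) , refl) = inj₁ (refl , refl) , refl
≈ᵉ-sym {e = u , v , s} {u′ , v′ , s′} (inj₂ (refl , refl) , refl) = inj₂ (refl , refl) , refl

≈ᵉ-joins : ∀ {n} {e e′ : Edge n} {a b} → e′ ≈ᵉ e → Joinsᵉ e a b → Joinsᵉ e′ a b
≈ᵉ-joins {e = u , v , s} {u′ , v′ , s′} (inj₁ (refl , refl) , _) j = j
≈ᵉ-joins {e = u , v , s} {u′ , v′ , s′} (inj₂ (refl , refl) , _) (inj₁ (refl , refl)) = inj₂ (refl , refl)
≈ᵉ-joins {e = u , v , s} {u′ , v′ , s′} (inj₂ (refl , refl) , _) (inj₂ (refl , refl)) = inj₁ (refl , refl)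

≈ᵉ-sign : ∀ {n} {e e′ : Edge n} → e ≈ᵉ e′ → signᵉ e ≡ signᵉ e′
≈ᵉ-sign {e′ = u , v , s} = proj₂

≈ᵉ-trans : ∀ {n} {e e′ e″ : Edge n} → e ≈ᵉ e′ → e′ ≈ᵉ e″ → e ≈ᵉ e″
≈ᵉ-trans {e″ = u , v , s} e≈e′ (j , eq) = ≈ᵉ-joins e≈e′ j , trans (≈ᵉ-sign e≈e′) eq

record Circuitⁱ {n m} (g : IndexedGraph n m) (S : Subset m) : Set where
  field
    k         : ℕ
    verts     : Fin (suc k) → Fin n
    edges     : Fin (suc k) → Fin m
    verts-inj : Injective _≡_ _≡_ verts
    edges-inj : Injective _≡_ _≡_ edges
    edges-in  : ∀ i → edges i ∈ S
    joins     : ∀ i → Joinsᵉ (g (edges i)) (verts i) (verts (next i))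

  signs : Fin (suc k) → Bool
  signs = signᵉ ∘ g ∘ edges

Negativeⁱ : ∀ {n m} {g : IndexedGraph n m} {S} → Circuitⁱ g S → Set
Negativeⁱ C = parity (Circuitⁱ.signs C) ≡ true

NegativeCircuitⁱ : ∀ {n m} → IndexedGraph n m → Subset m → Set
NegativeCircuitⁱ g S = Σ (Circuitⁱ g S) Negativeⁱ

Balancedⁱ : ∀ {n m} → IndexedGraph n m → Subset m → Set
Balancedⁱ g S = ¬ NegativeCircuitⁱ g S

-- Joins G e and sign G e are definitionally Joinsᵉ and signᵉ of List.lookup G e.
module _ {n} (G : SignedGraph n) {S : EdgeSet G} where

  balanced⇒balancedⁱ : Balanced G S → Balancedⁱ (List.lookup G) S
  balanced⇒balancedⁱ bal (C , neg) = bal (record { Circuitⁱ C } , neg)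

  balancedⁱ⇒balanced : Balancedⁱ (List.lookup G) S → Balanced G S
  balancedⁱ⇒balanced bal (C , neg) = bal (record { Circuit C } , neg)

module _ {n m₁ m₂} {g₁ : IndexedGraph n m₁} {g₂ : IndexedGraph n m₂} {S₁ S₂}
         (φ : Fin m₁ → Fin m₂) (φ-inj : Injective _≡_ _≡_ φ)
         (φ-edge : ∀ e → g₂ (φ e) ≈ᵉ g₁ e) (φ-∈ : ∀ {e} → e ∈ S₁ → φ e ∈ S₂) where

  negativeCircuit-embed : NegativeCircuitⁱ g₁ S₁ → NegativeCircuitⁱ g₂ S₂
  negativeCircuit-embed (C , neg) = C′ , trans (parity-cong (λ i → ≈ᵉ-sign (φ-edge (edges i)))) neg
    where
    open Circuitⁱ C
    C′ : Circuitⁱ g₂ S₂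
    C′ = record
      { k = k ; verts = verts ; edges = φ ∘ edges ; verts-inj = verts-inj
      ; edges-inj = edges-inj ∘ φ-inj
      ; edges-in  = φ-∈ ∘ edges-in
      ; joins     = λ i → ≈ᵉ-joins (φ-edge (edges i)) (joins i) }

module _ {n m} {g : IndexedGraph n m} {S : Subset m} where

  rotate : ℕ → Circuitⁱ g S → Circuitⁱ g S
  rotate c C = record
    { k = k ; verts = verts ∘ next^ c ; edges = edges ∘ next^ c
    ; verts-inj = next^-injective c ∘ verts-inj
    ; edges-inj = next^-injective c ∘ edges-inj
    ; edges-in  = edges-in ∘ next^ c
    ; joins     = λ i → subst (Joinsᵉ (g (edges (next^ c i))) (verts (next^ c i)) ∘ verts)
                              (sym (next^-next c i)) (joins (next^ c i)) }
    where open Circuitⁱ C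

  rotate-negative : ∀ c (C : Circuitⁱ g S) → Negativeⁱ C → Negativeⁱ (rotate c C)
  rotate-negative c C neg = trans (parity-∘next^ c (Circuitⁱ.signs C)) neg

-- Frustration, criticality and decomposability relative to a balance predicate

-- With B = Balanced G these are definitionally FrustrationIndex G, CriticalOn G and Decomposable G.
module _ {m} (B : Subset m → Set) where

  IsFrustrationIndex : Subset m → ℕ → Set
  IsFrustrationIndex S l =
    (Σ[ E ∈ Subset m ] E ⊆ S × ∣ E ∣ ≡ l × B (S ─ E))
    × (∀ (F : Subset m) → F ⊆ S → B (S ─ F) → l ≤ ∣ F ∣)

  IsCritical : Subset m → ℕ → Set
  IsCritical S k = 1 ≤ k × IsFrustrationIndex S k
    × (∀ e → e ∈ S → Σ[ l ∈ ℕ ] l < k × IsFrustrationIndex (S - e) l)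

  IsDecomposable : Set
  IsDecomposable =
    Σ[ k ∈ ℕ ] IsCritical ⊤ k ×
    (Σ[ r ∈ ℕ ] 2 ≤ r ×
     Σ[ ks ∈ (Fin r → ℕ) ] (∀ i → 1 ≤ ks i) × sumF ks ≡ k ×
     Σ[ Hs ∈ (Fin r → Subset m) ]
       (∀ i j → i ≢ j → Hs i ∩ Hs j ≡ ⊥) × (∀ i → IsCritical (Hs i) (ks i)))

  frustrationIndex-unique : ∀ {S l l′} → IsFrustrationIndex S l → IsFrustrationIndex S l′ → l ≡ l′
  frustrationIndex-unique ((E , E⊆ , ∣E∣≡l , bal) , min) ((E′ , E′⊆ , ∣E′∣≡l′ , bal′) , min′) =
    ℕ.≤-antisym (subst (_ ≤_) ∣E′∣≡l′ (min E′ E′⊆ bal′)) (subst (_ ≤_) ∣E∣≡l (min′ E E⊆ bal))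

critical-transfer : ∀ {m m′} (B : Subset m → Set) (B′ : Subset m′ → Set) {S S′ k} →
  (∀ l → IsFrustrationIndex B S l → IsFrustrationIndex B′ S′ l) →
  (∀ e′ → e′ ∈ S′ → Σ[ e ∈ Fin m ] e ∈ S ×
                       (∀ l → IsFrustrationIndex B (S - e) l → IsFrustrationIndex B′ (S′ - e′) l)) →
  IsCritical B S k → IsCritical B′ S′ k
critical-transfer B B′ {k = k} fi⇒ minus⇒ (1≤k , fi , minus) = 1≤k , fi⇒ k fi , λ e′ e′∈ →
  let (e , e∈ , fi⇒′) = minus⇒ e′ e′∈
      (l , l<k , fl) = minus e e∈
  in l , l<k , fi⇒′ l fl

record Equivalent {m m′} (B : Subset m → Set) (B′ : Subset m′ → Set) (k : ℕ) : Set where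
  constructor mkEquivalent
  field
    frustrationIndex⇔ : (l : ℕ) → IsFrustrationIndex B ⊤ l ⇔ IsFrustrationIndex B′ ⊤ l
    critical⇔         : IsCritical B ⊤ k ⇔ IsCritical B′ ⊤ k
    decomposable⇔     : IsDecomposable B ⇔ IsDecomposable B′

Equivalent-refl : ∀ {m} {B : Subset m → Set} {k} → Equivalent B B k
Equivalent-refl = mkEquivalent (λ _ → ⇔-id _) (⇔-id _) (⇔-id _)

Equivalent-trans : ∀ {m₁ m₂ m₃} {B₁ : Subset m₁ → Set} {B₂ : Subset m₂ → Set} {B₃ : Subset m₃ → Set} {k} →
  Equivalent B₁ B₂ k → Equivalent B₂ B₃ k → Equivalent B₁ B₃ k
Equivalent-trans (mkEquivalent fi cr dc) (mkEquivalent fi′ cr′ dc′) =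
  mkEquivalent (λ l → fi′ l ⇔-∘ fi l) (cr′ ⇔-∘ cr) (dc′ ⇔-∘ dc)

Equivalent-sym : ∀ {m m′} {B : Subset m → Set} {B′ : Subset m′ → Set} {k} → Equivalent B B′ k → Equivalent B′ B k
Equivalent-sym (mkEquivalent fi cr dc) = mkEquivalent (⇔-sym ∘ fi) (⇔-sym cr) (⇔-sym dc)

module Relabel {m m′} (π : Permutation m m′) (B : Subset m → Set) (B′ : Subset m′ → Set)
  (B⇒B′ : ∀ S → B S → B′ (π ⟨$⟩ˢ S)) (B′⇒B : ∀ S′ → B′ S′ → B (Perm.flip π ⟨$⟩ˢ S′)) where

  frustrationIndex : ∀ S l → IsFrustrationIndex B S l → IsFrustrationIndex B′ (π ⟨$⟩ˢ S) l
  frustrationIndex S l ((E , E⊆S , ∣E∣≡l , bal) , min) =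
    (π ⟨$⟩ˢ E , ⟨$⟩ˢ-⊆ π E⊆S , trans (∣⟨$⟩ˢ∣ π E) ∣E∣≡l , subst B′ (⟨$⟩ˢ-─ π S E) (B⇒B′ _ bal)) ,
    λ F F⊆ bal′ → subst (l ≤_) (∣⟨$⟩ˢ∣ (Perm.flip π) F)
      (min (Perm.flip π ⟨$⟩ˢ F) (subst (_ ⊆_) (flip-⟨$⟩ˢ π S) (⟨$⟩ˢ-⊆ (Perm.flip π) F⊆))
           (subst B (trans (⟨$⟩ˢ-─ (Perm.flip π) (π ⟨$⟩ˢ S) F) (cong (_─ _) (flip-⟨$⟩ˢ π S))) (B′⇒B _ bal′)))

  critical : ∀ S k → IsCritical B S k → IsCritical B′ (π ⟨$⟩ˢ S) k
  critical S k = critical-transfer B B′ (frustrationIndex S) λ e′ e′∈ →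
    π ⟨$⟩ˡ e′ , ∈-⟨$⟩ˢ⁻ π e′∈ , λ l → subst (λ S′ → IsFrustrationIndex B′ S′ l)
      (trans (⟨$⟩ˢ-- π S (π ⟨$⟩ˡ e′)) (cong ((π ⟨$⟩ˢ S) -_) (inverseʳ π))) ∘ frustrationIndex _ l

  decomposable : IsDecomposable B → IsDecomposable B′
  decomposable (k , crit , r , 2≤r , ks , 1≤ks , sum≡k , Hs , disjoint , crits) =
    k , subst (λ S → IsCritical B′ S k) (⟨$⟩ˢ-replicate π true) (critical ⊤ k crit) ,
    r , 2≤r , ks , 1≤ks , sum≡k , (λ i → π ⟨$⟩ˢ Hs i) ,
    (λ i j i≢j → trans (sym (⟨$⟩ˢ-∩ π (Hs i) (Hs j)))
                   (trans (cong (π ⟨$⟩ˢ_) (disjoint i j i≢j)) (⟨$⟩ˢ-replicate π false))) ,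
    λ i → critical (Hs i) (ks i) (crits i)

  frustrationIndex-⊤ : ∀ l → IsFrustrationIndex B ⊤ l → IsFrustrationIndex B′ ⊤ l
  frustrationIndex-⊤ l = subst (λ S → IsFrustrationIndex B′ S l) (⟨$⟩ˢ-replicate π true) ∘ frustrationIndex ⊤ l

  critical-⊤ : ∀ k → IsCritical B ⊤ k → IsCritical B′ ⊤ k
  critical-⊤ k = subst (λ S → IsCritical B′ S k) (⟨$⟩ˢ-replicate π true) ∘ critical ⊤ k

relabel-equivalent : ∀ {m m′} (π : Permutation m m′) {B : Subset m → Set} {B′ : Subset m′ → Set} {k} →
  (∀ S → B S → B′ (π ⟨$⟩ˢ S)) → (∀ S′ → B′ S′ → B (Perm.flip π ⟨$⟩ˢ S′)) → Equivalent B B′ k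
relabel-equivalent π {B} {B′} {k} B⇒B′ B′⇒B = mkEquivalent
  (λ l → mk⇔ (R.frustrationIndex-⊤ l) (R⁻¹.frustrationIndex-⊤ l))
  (mk⇔ (R.critical-⊤ k) (R⁻¹.critical-⊤ k)) (mk⇔ R.decomposable R⁻¹.decomposable)
  where
  module R   = Relabel π B B′ B⇒B′ B′⇒B
  module R⁻¹ = Relabel (Perm.flip π) B′ B B′⇒B B⇒B′

-- Two balance problems with the same frustration index

module _ {m m′} (B : Subset m → Set) (S : Subset m) (B′ : Subset m′ → Set) (S′ : Subset m′) where

  Simulates : Set
  Simulates = ∀ F → F ⊆ S → B (S ─ F) → Σ[ F′ ∈ Subset m′ ] F′ ⊆ S′ × ∣ F′ ∣ ≤ ∣ F ∣ × B′ (S′ ─ F′)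

Simulates⇒frustrationIndex : ∀ {m m′} {B : Subset m → Set} {S} {B′ : Subset m′ → Set} {S′} →
  Simulates B S B′ S′ → Simulates B′ S′ B S → ∀ l → IsFrustrationIndex B S l → IsFrustrationIndex B′ S′ l
Simulates⇒frustrationIndex {B′ = B′} {S′} sim sim′ l ((E , E⊆ , ∣E∣≡l , bal) , min) =
  let (E′ , E′⊆ , ∣E′∣≤ , bal′) = sim E E⊆ bal in
  (E′ , E′⊆ , ℕ.≤-antisym (subst (∣ E′ ∣ ≤_) ∣E∣≡l ∣E′∣≤) (min′ E′ E′⊆ bal′) , bal′) , min′
  where
  min′ : ∀ F′ → F′ ⊆ S′ → B′ (S′ ─ F′) → l ≤ ∣ F′ ∣
  min′ F′ F′⊆ bal′ = let (F , F⊆ , ∣F∣≤ , bal) = sim′ F′ F′⊆ bal′ in ℕ.≤-trans (min F F⊆ bal) ∣F∣≤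

-- Isomorphisms fixing the vertices

infix 4 _≅_

record _≅_ {n m m′} (g : IndexedGraph n m) (g′ : IndexedGraph n m′) : Set where
  constructor mk≅
  field
    relabel : Permutation m m′
    edge≈   : ∀ e → g′ (relabel ⟨$⟩ʳ e) ≈ᵉ g e

module _ {n : ℕ} where

  ≅-sym : ∀ {m m′} {g : IndexedGraph n m} {g′ : IndexedGraph n m′} → g ≅ g′ → g′ ≅ g
  ≅-sym {g = g} {g′} (mk≅ π edge≈) = mk≅ (Perm.flip π) λ e →
    ≈ᵉ-sym (subst (λ e′ → g′ e′ ≈ᵉ g (π ⟨$⟩ˡ e)) (inverseʳ π) (edge≈ (π ⟨$⟩ˡ e)))

  ≅-trans : ∀ {m₁ m₂ m₃} {g₁ : IndexedGraph n m₁} {g₂ : IndexedGraph n m₂} {g₃ : IndexedGraph n m₃} →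
    g₁ ≅ g₂ → g₂ ≅ g₃ → g₁ ≅ g₃
  ≅-trans (mk≅ π edge≈) (mk≅ ρ edge≈′) = mk≅ (π Perm.∘ₚ ρ) λ e → ≈ᵉ-trans (edge≈′ _) (edge≈ e)

  ≅-refl : ∀ {m} {g : IndexedGraph n m} → g ≅ g
  ≅-refl {g = g} = mk≅ Perm.id (≈ᵉ-refl ∘ g)

  ≅-const : ∀ {m m′} {g : IndexedGraph n m} {e₀ : Edge n} → Permutation m m′ → (∀ e → g e ≈ᵉ e₀) →
    g ≅ (λ (_ : Fin m′) → e₀)
  ≅-const π g≈e₀ = mk≅ π (≈ᵉ-sym ∘ g≈e₀)

  infixr 5 _⊕ₚ_

  _⊕ₚ_ : ∀ {a a′ b b′} → Permutation a a′ → Permutation b b′ → Permutation (a + b) (a′ + b′)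
  π ⊕ₚ ρ = ↔-trans Fin.+↔⊎ (↔-trans (π ⊎-↔ ρ) (↔-sym Fin.+↔⊎))

  ⊕ₚ-↑ˡ : ∀ {a a′ b b′} (π : Permutation a a′) (ρ : Permutation b b′) i →
    (π ⊕ₚ ρ) ⟨$⟩ʳ (i ↑ˡ b) ≡ (π ⟨$⟩ʳ i) ↑ˡ b′
  ⊕ₚ-↑ˡ {a} {a′} {b} {b′} π ρ i = cong (join a′ b′ ∘ Sum.map (π ⟨$⟩ʳ_) (ρ ⟨$⟩ʳ_)) (Fin.splitAt-↑ˡ a i b)

  ⊕ₚ-↑ʳ : ∀ {a a′ b b′} (π : Permutation a a′) (ρ : Permutation b b′) j →
    (π ⊕ₚ ρ) ⟨$⟩ʳ (a ↑ʳ j) ≡ a′ ↑ʳ (ρ ⟨$⟩ʳ j)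
  ⊕ₚ-↑ʳ {a} {a′} {b} {b′} π ρ j = cong (join a′ b′ ∘ Sum.map (π ⟨$⟩ʳ_) (ρ ⟨$⟩ʳ_)) (Fin.splitAt-↑ʳ a b j)

  ≅-++ᶠ : ∀ {a a′ b b′} {g₁ : IndexedGraph n a} {g₁′ : IndexedGraph n a′}
            {g₂ : IndexedGraph n b} {g₂′ : IndexedGraph n b′} →
    g₁ ≅ g₁′ → g₂ ≅ g₂′ → g₁ ++ᶠ g₂ ≅ g₁′ ++ᶠ g₂′
  ≅-++ᶠ {a} {a′} {b} {b′} {g₁} {g₁′} {g₂} {g₂′} (mk≅ π edge≈) (mk≅ ρ edge≈′) = mk≅ (π ⊕ₚ ρ) edge≈″
    where
    edge≈″ : ∀ e → (g₁′ ++ᶠ g₂′) ((π ⊕ₚ ρ) ⟨$⟩ʳ e) ≈ᵉ (g₁ ++ᶠ g₂) e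
    edge≈″ e with ↑view a b e
    ... | ↑ˡ-view i = subst₂ _≈ᵉ_
            (sym (trans (cong (g₁′ ++ᶠ g₂′) (⊕ₚ-↑ˡ π ρ i)) (lookup-++ᶠˡ g₁′ g₂′ (π ⟨$⟩ʳ i))))
            (sym (lookup-++ᶠˡ g₁ g₂ i)) (edge≈ i)
    ... | ↑ʳ-view j = subst₂ _≈ᵉ_
            (sym (trans (cong (g₁′ ++ᶠ g₂′) (⊕ₚ-↑ʳ π ρ j)) (lookup-++ᶠʳ g₁′ g₂′ (ρ ⟨$⟩ʳ j))))
            (sym (lookup-++ᶠʳ g₁ g₂ j)) (edge≈′ j)

  ↭⇒≅ : ∀ {xs ys : SignedGraph n} → xs ↭ ys → List.lookup xs ≅ List.lookup ys
  ↭⇒≅ xs↭ys = mk≅ (onIndices (↭⇒↭ₛ xs↭ys)) λ e →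
    subst (_≈ᵉ _) (onIndices-lookup (↭⇒↭ₛ xs↭ys) e) (≈ᵉ-refl _)
    where
    open PermutationSetoid (setoid (Edge n)) using (onIndices)
    open PermutationSetoidProperties (setoid (Edge n)) using (onIndices-lookup)

  ++ᶠ-suc : ∀ {a b} {A : Set} (f : Fin (suc a) → A) (g : Fin b → A) e → (f ++ᶠ g) (suc e) ≡ ((f ∘ suc) ++ᶠ g) e
  ++ᶠ-suc {a} f g e with splitAt a e
  ... | inj₁ _ = refl
  ... | inj₂ _ = refl

  ++⇒≅ : ∀ (xs ys : SignedGraph n) → List.lookup (xs List.++ ys) ≅ List.lookup xs ++ᶠ List.lookup ys
  ++⇒≅ List.[]       ys = mk≅ Perm.id (≈ᵉ-refl ∘ List.lookup ys)
  ++⇒≅ (x List.∷ xs) ys with ++⇒≅ xs ys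
  ... | mk≅ π edge≈ = mk≅ (Perm.lift₀ π) λ
    { zero    → ≈ᵉ-refl x
    ; (suc e) → subst (_≈ᵉ _) (sym (++ᶠ-suc (List.lookup (x List.∷ xs)) (List.lookup ys) (π ⟨$⟩ʳ e))) (edge≈ e) }

  map⇒≅ : ∀ {n′} (f : Edge n′ → Edge n) (xs : SignedGraph n′) → List.lookup (List.map f xs) ≅ f ∘ List.lookup xs
  map⇒≅ f List.[]       = mk≅ Perm.id λ ()
  map⇒≅ f (x List.∷ xs) with map⇒≅ f xs
  ... | mk≅ π edge≈ = mk≅ (Perm.lift₀ π) λ { zero → ≈ᵉ-refl (f x) ; (suc e) → edge≈ e }

  replicate⇒≅ : ∀ t (e₀ : Edge n) → List.lookup (List.replicate t e₀) ≅ (λ (_ : Fin t) → e₀)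
  replicate⇒≅ t e₀ = ≅-const (Perm.cast-id (length-replicate t)) (lookup≈ t)
    where
    lookup≈ : ∀ t e → List.lookup (List.replicate t e₀) e ≈ᵉ e₀
    lookup≈ (suc t) zero    = ≈ᵉ-refl e₀
    lookup≈ (suc t) (suc e) = lookup≈ t e

≅-balanced : ∀ {n m m′} {g : IndexedGraph n m} {g′ : IndexedGraph n m′} (g≅g′ : g ≅ g′) →
  ∀ S → Balancedⁱ g S → Balancedⁱ g′ (_≅_.relabel g≅g′ ⟨$⟩ˢ S)
≅-balanced g≅g′@(mk≅ π _) S bal = bal ∘ negativeCircuit-embed (π ⟨$⟩ˡ_)
  (λ eq → trans (sym (inverseʳ π)) (trans (cong (π ⟨$⟩ʳ_) eq) (inverseʳ π)))
  (_≅_.edge≈ (≅-sym g≅g′)) (∈-⟨$⟩ˢ⁻ π)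

-- Circuits through a pair of parallel edges, lifting and restriction

endpoint-of : ∀ {n} {a b c d w : Fin n} {σ : Bool} → Joinsᵉ (a , b , σ) c d → w ≡ a ⊎ w ≡ b → w ≡ c ⊎ w ≡ d
endpoint-of (inj₁ (refl , refl)) (inj₁ refl) = inj₁ refl
endpoint-of (inj₁ (refl , refl)) (inj₂ refl) = inj₂ refl
endpoint-of (inj₂ (refl , refl)) (inj₁ refl) = inj₂ refl
endpoint-of (inj₂ (refl , refl)) (inj₂ refl) = inj₁ refl

endpoints : ∀ {n} {a b c d : Fin n} {σ : Bool} → Joinsᵉ (a , b , σ) c d → (c ≡ a ⊎ c ≡ b) × (d ≡ a ⊎ d ≡ b)
endpoints (inj₁ (refl , refl)) = inj₁ refl , inj₂ refl
endpoints (inj₂ (refl , refl)) = inj₂ refl , inj₁ refl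

parity-two-equal : ∀ {k} (f : Fin (suc k) → Bool) i {σ} → k ≡ 1 → f i ≡ σ → f (next i) ≡ σ → parity f ≡ false
parity-two-equal f zero          refl p q with f zero | f (suc zero) | p | q
... | true  | true  | refl | refl = refl
... | false | false | refl | refl = refl
parity-two-equal f (suc zero)    refl p q with f zero | f (suc zero) | p | q
... | true  | true  | refl | refl = refl
... | false | false | refl | refl = refl

-- Both edges join the same two vertices, so the circuit has length two.
parallel⇒positive : ∀ {n m} {g : IndexedGraph n m} {S} (C : Circuitⁱ g S) {i i′ a b σ} → i ≢ i′ →
  let open Circuitⁱ C in g (edges i) ≈ᵉ (a , b , σ) → g (edges i′) ≈ᵉ (a , b , σ) → parity signs ≡ false
parallel⇒positive {g = g} C {i} {i′} {a} {b} {σ} i≢i′ e≈ e′≈ =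
  parity-two-equal signs i (next²≡id⇒k≡1 i next²i≡i (λ p → i≢i′ (sym (trans i′≡next-i p))))
    (≈ᵉ-sign e≈) (subst (λ j → signs j ≡ σ) i′≡next-i (≈ᵉ-sign e′≈))
  where
  open Circuitⁱ C
  i-joins : Joinsᵉ (a , b , σ) (verts i) (verts (next i))
  i-joins = ≈ᵉ-joins {e = g (edges i)} (≈ᵉ-sym e≈) (joins i)
  i′-ends : (verts i′ ≡ a ⊎ verts i′ ≡ b) × (verts (next i′) ≡ a ⊎ verts (next i′) ≡ b)
  i′-ends = endpoints {a = a} {b} {verts i′} {verts (next i′)} {σ} (≈ᵉ-joins (≈ᵉ-sym e′≈) (joins i′))
  i′≡next-i : i′ ≡ next i
  i′≡next-i with endpoint-of {a = a} {b} {verts i} {verts (next i)} {verts i′} {σ} i-joins (proj₁ i′-ends)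
  ... | inj₁ p = ⊥-elim (i≢i′ (sym (verts-inj {i′} {i} p)))
  ... | inj₂ p = verts-inj {i′} {next i} p
  next²i≡i : next (next i) ≡ i
  next²i≡i with endpoint-of {a = a} {b} {verts i} {verts (next i)} {verts (next i′)} {σ} i-joins (proj₂ i′-ends)
  ... | inj₁ p = subst (λ j → next j ≡ i) i′≡next-i (verts-inj {next i′} {i} p)
  ... | inj₂ p = ⊥-elim (i≢i′ (sym (next-injective (verts-inj {next i′} {next i} p))))

module _ {n a b} {g₁ : IndexedGraph n a} {g₂ : IndexedGraph n b} {R : Subset a} {Z : Subset b} where

  restrictˡ : (C : Circuitⁱ (g₁ ++ᶠ g₂) (R ++ Z)) → (∀ p → Σ[ i ∈ Fin a ] Circuitⁱ.edges C p ≡ i ↑ˡ b) →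
    Negativeⁱ C → NegativeCircuitⁱ g₁ R
  restrictˡ C onLeft neg = C′ , trans (parity-cong (λ p → cong signᵉ (sym (edge≡ p)))) neg
    where
    open Circuitⁱ C
    ix : Fin (suc k) → Fin a
    ix p = proj₁ (onLeft p)
    edge≡ : ∀ p → (g₁ ++ᶠ g₂) (edges p) ≡ g₁ (ix p)
    edge≡ p = trans (cong (g₁ ++ᶠ g₂) (proj₂ (onLeft p))) (lookup-++ᶠˡ g₁ g₂ (ix p))
    C′ : Circuitⁱ g₁ R
    C′ = record
      { k = k ; verts = verts ; edges = ix ; verts-inj = verts-inj
      ; edges-inj = λ {p} {q} eq → edges-inj (trans (proj₂ (onLeft p)) (trans (cong (_↑ˡ b) eq) (sym (proj₂ (onLeft q)))))
      ; edges-in  = λ p → ∈-++⁻ˡ {q = Z} (subst (_∈ R ++ Z) (proj₂ (onLeft p)) (edges-in p))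
      ; joins     = λ p → subst (λ e → Joinsᵉ e (verts p) (verts (next p))) (edge≡ p) (joins p) }

↑ˡ⊎↑ʳ : ∀ {a b} (e : Fin (a + b)) → (Σ[ i ∈ Fin a ] e ≡ i ↑ˡ b) ⊎ (Σ[ j ∈ Fin b ] e ≡ a ↑ʳ j)
↑ˡ⊎↑ʳ {a} {b} e with ↑view a b e
... | ↑ˡ-view i = inj₁ (i , refl)
... | ↑ʳ-view j = inj₂ (j , refl)

↑ˡ-or-↑ʳ : ∀ {k a b} (f : Fin k → Fin (a + b)) →
  (∀ p → Σ[ i ∈ Fin a ] f p ≡ i ↑ˡ b) ⊎ (Σ[ p ∈ Fin k ] Σ[ j ∈ Fin b ] f p ≡ a ↑ʳ j)
↑ˡ-or-↑ʳ {zero}  f = inj₁ λ ()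
↑ˡ-or-↑ʳ {suc k} f with ↑ˡ⊎↑ʳ (f zero) | ↑ˡ-or-↑ʳ (f ∘ suc)
... | inj₂ (j , f0≡) | _                  = inj₂ (zero , j , f0≡)
... | inj₁ _         | inj₂ (p , j , fp≡) = inj₂ (suc p , j , fp≡)
... | inj₁ f0≡       | inj₁ onLeft        = inj₁ λ { zero → f0≡ ; (suc p) → onLeft p }

Joinsᵉ-lift : ∀ {n} (e : Edge n) {a b} → Joinsᵉ e a b → Joinsᵉ (liftEdge e) (inject₁ a) (inject₁ b)
Joinsᵉ-lift (u , v , _) (inj₁ (refl , refl)) = inj₁ (refl , refl)
Joinsᵉ-lift (u , v , _) (inj₂ (refl , refl)) = inj₂ (refl , refl)

Joinsᵉ-unlift : ∀ {n} (e : Edge n) {a b} → Joinsᵉ (liftEdge e) (inject₁ a) (inject₁ b) → Joinsᵉ e a b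
Joinsᵉ-unlift (u , v , _) (inj₁ (p , q)) = inj₁ (inject₁-injective p , inject₁-injective q)
Joinsᵉ-unlift (u , v , _) (inj₂ (p , q)) = inj₂ (inject₁-injective p , inject₁-injective q)

liftEdge-ends : ∀ {n} (e : Edge n) {a b} → Joinsᵉ (liftEdge e) a b →
  (Σ[ a′ ∈ Fin n ] a ≡ inject₁ a′) × (Σ[ b′ ∈ Fin n ] b ≡ inject₁ b′)
liftEdge-ends (u , v , _) (inj₁ (refl , refl)) = (u , refl) , (v , refl)
liftEdge-ends (u , v , _) (inj₂ (refl , refl)) = (v , refl) , (u , refl)

liftEdge-avoids-fromℕ : ∀ {n} (e : Edge n) {a b} → Joinsᵉ (liftEdge e) a b → a ≢ fromℕ n × b ≢ fromℕ n
liftEdge-avoids-fromℕ e J with liftEdge-ends e J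
... | (_ , refl) , (_ , refl) = (λ p → fromℕ≢inject₁ (sym p)) , (λ p → fromℕ≢inject₁ (sym p))

module _ {n m} {f : IndexedGraph n m} {S : Subset m} where

  liftCircuit : NegativeCircuitⁱ f S → NegativeCircuitⁱ (liftEdge ∘ f) S
  liftCircuit (C , neg) = record
    { k = k ; verts = inject₁ ∘ verts ; edges = edges
    ; verts-inj = verts-inj ∘ inject₁-injective ; edges-inj = edges-inj ; edges-in = edges-in
    ; joins = λ i → Joinsᵉ-lift (f (edges i)) (joins i) } , neg
    where open Circuitⁱ C

  unliftCircuit : NegativeCircuitⁱ (liftEdge ∘ f) S → NegativeCircuitⁱ f S
  unliftCircuit (C , neg) = record
    { k = k ; verts = verts′ ; edges = edges
    ; verts-inj = λ {i} {j} eq → verts-inj (trans (verts≡ i) (trans (cong inject₁ eq) (sym (verts≡ j))))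
    ; edges-inj = edges-inj ; edges-in = edges-in
    ; joins = λ i → Joinsᵉ-unlift (f (edges i))
        (subst₂ (Joinsᵉ (liftEdge (f (edges i)))) (verts≡ i) (verts≡ (next i)) (joins i)) } , neg
    where
    open Circuitⁱ C
    verts′ : Fin (suc k) → Fin n
    verts′ i = proj₁ (proj₁ (liftEdge-ends (f (edges i)) (joins i)))
    verts≡ : ∀ i → verts i ≡ inject₁ (verts′ i)
    verts≡ i = proj₂ (proj₁ (liftEdge-ends (f (edges i)) (joins i)))

lower : ∀ {n} (u : Fin (suc n)) → u ≢ fromℕ n → Fin n
lower {n} u u≢ = lower₁ u (λ n≡ → u≢ (toℕ-injective (trans (sym n≡) (sym (toℕ-fromℕ n)))))

inject₁-lower : ∀ {n} (u : Fin (suc n)) (u≢ : u ≢ fromℕ n) → inject₁ (lower u u≢) ≡ u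
inject₁-lower u u≢ = Fin.inject₁-lower₁ u _

-- Subdividing a multiedge

-- Up to relabelling edges, the two sides of a subdivision step are g and h below. Edge sets of g
-- and h are written R ++ Z and R ++ (X ++ Y): Z inside the multiedge, X and Y inside its halves.
module Subdivide {n r t : ℕ} (rest : Fin r → Edge n) (x y : Fin n) (s : Bool) where

  v : Fin (suc n)
  v = fromℕ n

  xy : Edge n
  xy = x , y , s

  vx vy : Edge (suc n)
  vx = v , inject₁ x , false
  vy = v , inject₁ y , s

  xys : IndexedGraph n t
  xys _ = xy

  vxys : IndexedGraph (suc n) (t + t)
  vxys = _++ᶠ_ {m = t} (λ _ → vx) (λ _ → vy)

  g : IndexedGraph n (r + t)
  g = rest ++ᶠ xys

  h : IndexedGraph (suc n) (r + (t + t))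
  h = (liftEdge ∘ rest) ++ᶠ vxys

  restᵍ : Fin r → Fin (r + t)
  restᵍ i = i ↑ˡ t

  xyᵍ : Fin t → Fin (r + t)
  xyᵍ j = r ↑ʳ j

  restʰ : Fin r → Fin (r + (t + t))
  restʰ i = i ↑ˡ (t + t)

  vxʰ vyʰ : Fin t → Fin (r + (t + t))
  vxʰ a = r ↑ʳ (a ↑ˡ t)
  vyʰ b = r ↑ʳ (t ↑ʳ b)

  g-restᵍ : ∀ i → g (restᵍ i) ≡ rest i
  g-restᵍ = lookup-++ᶠˡ rest xys

  g-xyᵍ : ∀ j → g (xyᵍ j) ≡ xy
  g-xyᵍ = lookup-++ᶠʳ rest xys

  h-restʰ : ∀ i → h (restʰ i) ≡ liftEdge (rest i)
  h-restʰ = lookup-++ᶠˡ (liftEdge ∘ rest) vxys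

  h-vxʰ : ∀ a → h (vxʰ a) ≡ vx
  h-vxʰ a = trans (lookup-++ᶠʳ (liftEdge ∘ rest) vxys (a ↑ˡ t)) (lookup-++ᶠˡ {m = t} {n = t} (λ _ → vx) (λ _ → vy) a)

  h-vyʰ : ∀ b → h (vyʰ b) ≡ vy
  h-vyʰ b = trans (lookup-++ᶠʳ (liftEdge ∘ rest) vxys (t ↑ʳ b)) (lookup-++ᶠʳ {m = t} {n = t} (λ _ → vx) (λ _ → vy) b)

  module _ (R : Subset r) (Z X Y : Subset t) where

    -- After rotation the multiedge edge comes last; by parallel⇒positive no other circuit edge
    -- lies in the multiedge, and the last one is replaced by the detour through v.
    module Reroute (C : Circuitⁱ g (R ++ Z)) (neg : Negativeⁱ C) (j : Fin t)
                   (last≡ : Circuitⁱ.edges C (fromℕ (Circuitⁱ.k C)) ≡ xyᵍ j) where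
      open Circuitⁱ C

      L : Fin (suc k)
      L = fromℕ k

      xy≈ : ∀ {p j′} → edges p ≡ xyᵍ j′ → g (edges p) ≈ᵉ xy
      xy≈ {j′ = j′} eq = subst (_≈ᵉ xy) (sym (trans (cong g eq) (g-xyᵍ j′))) (≈ᵉ-refl xy)

      others-rest : ∀ q → Σ[ i ∈ Fin r ] edges (inject₁ q) ≡ restᵍ i
      others-rest q with ↑ˡ⊎↑ʳ (edges (inject₁ q))
      ... | inj₁ on-rest    = on-rest
      ... | inj₂ (j′ , eq′) = ⊥-elim (true≢false (trans (sym neg)
              (parallel⇒positive C (λ p → fromℕ≢inject₁ (sym p)) (xy≈ eq′) (xy≈ last≡))))

      ix : Fin k → Fin r
      ix q = proj₁ (others-rest q)

      rest-sign : ∀ q → signᵉ (h (restʰ (ix q))) ≡ signs (inject₁ q)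
      rest-sign q = trans (cong signᵉ (h-restʰ (ix q)))
        (cong signᵉ (sym (trans (cong g (proj₂ (others-rest q))) (g-restᵍ (ix q)))))

      rest-joins : ∀ q → Joinsᵉ (h (restʰ (ix q))) (inject₁ (verts (inject₁ q))) (inject₁ (verts (suc q)))
      rest-joins q = subst (λ e → Joinsᵉ e _ _) (sym (h-restʰ (ix q)))
        (Joinsᵉ-lift (rest (ix q))
          (subst₂ (Joinsᵉ (rest (ix q))) refl (cong verts (next-inject₁ q))
            (subst (λ e → Joinsᵉ e _ _) (trans (cong g (proj₂ (others-rest q))) (g-restᵍ (ix q))) (joins (inject₁ q)))))

      parity-others : parity (signs ∘ inject₁) xor s ≡ true
      parity-others = trans (cong (parity (signs ∘ inject₁) xor_) (sym (≈ᵉ-sign (xy≈ last≡))))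
                            (trans (sym (parity-init-last signs)) neg)

      module Via (w₁ w₂ : Fin (t + t)) (w₁≢w₂ : w₁ ≢ w₂) (w₁∈ : w₁ ∈ X ++ Y) (w₂∈ : w₂ ∈ X ++ Y)
                 (J₁ : Joinsᵉ (h (r ↑ʳ w₁)) (inject₁ (verts L)) v)
                 (J₂ : Joinsᵉ (h (r ↑ʳ w₂)) v (inject₁ (verts zero)))
                 (σ₁₂ : signᵉ (h (r ↑ʳ w₁)) xor signᵉ (h (r ↑ʳ w₂)) ≡ s) where

        liftedVerts : Fin (suc k) → Fin (suc n)
        liftedVerts = inject₁ ∘ verts

        restEdges : Fin k → Fin (r + (t + t))
        restEdges = restʰ ∘ ix

        verts′ : Fin (suc (suc k)) → Fin (suc n)
        verts′ = snoc liftedVerts v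

        edges′ : Fin (suc (suc k)) → Fin (r + (t + t))
        edges′ = snoc (snoc restEdges (r ↑ʳ w₁)) (r ↑ʳ w₂)

        rest-injective : Injective _≡_ _≡_ restEdges
        rest-injective {q} {q′} eq = inject₁-injective (edges-inj (trans (proj₂ (others-rest q))
          (trans (cong restᵍ (Fin.↑ˡ-injective (t + t) _ _ eq)) (sym (proj₂ (others-rest q′))))))

        rest-∈ : ∀ q → restEdges q ∈ R ++ (X ++ Y)
        rest-∈ q = ∈-++⁺ˡ (∈-++⁻ˡ {q = Z} (subst (_∈ R ++ Z) (proj₂ (others-rest q)) (edges-in (inject₁ q))))

        edges′-last : edges′ (fromℕ (suc k)) ≡ r ↑ʳ w₂
        edges′-last = snoc-fromℕ (snoc restEdges (r ↑ʳ w₁)) (r ↑ʳ w₂)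

        edges′-penultimate : edges′ (inject₁ L) ≡ r ↑ʳ w₁
        edges′-penultimate = trans (snoc-inject₁ (snoc restEdges (r ↑ʳ w₁)) (r ↑ʳ w₂) L) (snoc-fromℕ restEdges (r ↑ʳ w₁))

        edges′-rest : ∀ q → edges′ (inject₁ (inject₁ q)) ≡ restEdges q
        edges′-rest q = trans (snoc-inject₁ (snoc restEdges (r ↑ʳ w₁)) (r ↑ʳ w₂) (inject₁ q))
                              (snoc-inject₁ restEdges (r ↑ʳ w₁) q)

        verts′-lifted : ∀ i → verts′ (inject₁ i) ≡ inject₁ (verts i)
        verts′-lifted = snoc-inject₁ liftedVerts v

        verts′-last : verts′ (fromℕ (suc k)) ≡ v
        verts′-last = snoc-fromℕ liftedVerts v

        joins′ : ∀ i → Joinsᵉ (h (edges′ i)) (verts′ i) (verts′ (next i))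
        joins′ i with injectOrLast i
        ... | fromℕ-view = subst₂ (λ e w → Joinsᵉ (h e) w (verts′ (next (fromℕ (suc k)))))
                (sym edges′-last) (sym verts′-last)
                (subst (Joinsᵉ (h (r ↑ʳ w₂)) v)
                       (sym (trans (cong verts′ (next-fromℕ (suc k))) (verts′-lifted zero))) J₂)
        ... | inject₁-view i₀ with injectOrLast i₀
        ...   | fromℕ-view = subst₂ (λ e w → Joinsᵉ (h e) w (verts′ (next (inject₁ L))))
                  (sym edges′-penultimate) (sym (verts′-lifted L))
                  (subst (Joinsᵉ (h (r ↑ʳ w₁)) (inject₁ (verts L)))
                         (sym (trans (cong verts′ (next-inject₁ L)) verts′-last)) J₁)
        ...   | inject₁-view q = subst₂ (λ e w → Joinsᵉ (h e) w (verts′ (next (inject₁ (inject₁ q)))))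
                  (sym (edges′-rest q)) (sym (verts′-lifted (inject₁ q)))
                  (subst (Joinsᵉ (h (restEdges q)) (inject₁ (verts (inject₁ q))))
                         (sym (trans (cong verts′ (next-inject₁ (inject₁ q))) (verts′-lifted (suc q)))) (rest-joins q))

        circuit : Circuitⁱ h (R ++ (X ++ Y))
        circuit = record
          { k = suc k ; verts = verts′ ; edges = edges′
          ; verts-inj = snoc-injective (verts-inj ∘ inject₁-injective) (λ _ eq → fromℕ≢inject₁ (sym eq))
          ; edges-inj = snoc-injective (snoc-injective rest-injective (λ q → ↑ˡ≢↑ʳ (ix q) w₁))
                          (snoc-all (_≢ r ↑ʳ w₂) (λ q → ↑ˡ≢↑ʳ (ix q) w₂) (w₁≢w₂ ∘ Fin.↑ʳ-injective r _ _))
          ; edges-in  = snoc-all (_∈ R ++ (X ++ Y))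
                          (snoc-all (_∈ R ++ (X ++ Y)) rest-∈ (∈-++⁺ʳ {p = R} w₁∈)) (∈-++⁺ʳ {p = R} w₂∈)
          ; joins     = joins′ }

        negative : Negativeⁱ circuit
        negative = begin
          parity (σ ∘ edges′)                                     ≡⟨ parity-cong (∘-snoc σ front (r ↑ʳ w₂)) ⟩
          parity (snoc (σ ∘ front) (σ (r ↑ʳ w₂)))                 ≡⟨ parity-snoc (σ ∘ front) (σ (r ↑ʳ w₂)) ⟩
          parity (σ ∘ front) xor σ (r ↑ʳ w₂)                      ≡⟨ cong (_xor σ (r ↑ʳ w₂))
                                                                      (trans (parity-cong (∘-snoc σ restEdges (r ↑ʳ w₁)))
                                                                             (parity-snoc (σ ∘ restEdges) (σ (r ↑ʳ w₁)))) ⟩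
          (parity (σ ∘ restEdges) xor σ (r ↑ʳ w₁)) xor σ (r ↑ʳ w₂) ≡⟨ xor-assoc (parity (σ ∘ restEdges)) _ _ ⟩
          parity (σ ∘ restEdges) xor (σ (r ↑ʳ w₁) xor σ (r ↑ʳ w₂)) ≡⟨ cong₂ _xor_ (parity-cong rest-sign) σ₁₂ ⟩
          parity (signs ∘ inject₁) xor s                         ≡⟨ parity-others ⟩
          true                                                   ∎
          where
          open ≡-Reasoning
          σ : Fin (r + (t + t)) → Bool
          σ = signᵉ ∘ h
          front : Fin (suc k) → Fin (r + (t + t))
          front = snoc restEdges (r ↑ʳ w₁)

        result : NegativeCircuitⁱ h (R ++ (X ++ Y))
        result = circuit , negative

      last-joins : Joinsᵉ xy (verts L) (verts zero)
      last-joins = subst₂ (λ e w → Joinsᵉ e (verts L) w)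
        (trans (cong g last≡) (g-xyᵍ j)) (cong verts (next-fromℕ k)) (joins L)

      rerouted : Nonempty X → Nonempty Y → NegativeCircuitⁱ h (R ++ (X ++ Y))
      rerouted (a , a∈X) (b , b∈Y) with last-joins
      ... | inj₁ (x≡ , y≡) = Via.result (a ↑ˡ t) (t ↑ʳ b) (↑ˡ≢↑ʳ a b) (∈-++⁺ˡ a∈X) (∈-++⁺ʳ b∈Y)
              (subst (λ e → Joinsᵉ e _ v) (sym (h-vxʰ a)) (inj₂ (refl , cong inject₁ x≡)))
              (subst (λ e → Joinsᵉ e v _) (sym (h-vyʰ b)) (inj₁ (refl , cong inject₁ y≡)))
              (cong₂ (λ e e′ → signᵉ e xor signᵉ e′) (h-vxʰ a) (h-vyʰ b))
      ... | inj₂ (x≡ , y≡) = Via.result (t ↑ʳ b) (a ↑ˡ t) (↑ˡ≢↑ʳ a b ∘ sym) (∈-++⁺ʳ b∈Y) (∈-++⁺ˡ a∈X)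
              (subst (λ e → Joinsᵉ e _ v) (sym (h-vyʰ b)) (inj₂ (refl , cong inject₁ y≡)))
              (subst (λ e → Joinsᵉ e v _) (sym (h-vxʰ a)) (inj₁ (refl , cong inject₁ x≡)))
              (trans (cong₂ (λ e e′ → signᵉ e xor signᵉ e′) (h-vyʰ b) (h-vxʰ a)) (xor-identityʳ s))

    negative-g⇒h : (Nonempty Z → Nonempty X × Nonempty Y) →
      NegativeCircuitⁱ g (R ++ Z) → NegativeCircuitⁱ h (R ++ (X ++ Y))
    negative-g⇒h hyp (C , neg) with ↑ˡ-or-↑ʳ (Circuitⁱ.edges C)
    ... | inj₁ on-rest = negativeCircuit-embed {S₁ = R} restʰ (Fin.↑ˡ-injective (t + t) _ _)
            (λ i → subst (_≈ᵉ _) (sym (h-restʰ i)) (≈ᵉ-refl _)) (∈-++⁺ˡ {q = X ++ Y})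
            (liftCircuit (restrictˡ {Z = Z} C on-rest neg))
    ... | inj₂ (p , j , edge≡) = uncurry (Reroute.rerouted C′ (rotate-negative c C neg) j last≡) (hyp (j , j∈Z))
      where
      c = suc (toℕ p)
      C′ = rotate c C
      last≡ : Circuitⁱ.edges C′ (fromℕ (Circuitⁱ.k C)) ≡ xyᵍ j
      last≡ = trans (cong (Circuitⁱ.edges C) (next^-fromℕ p)) edge≡
      j∈Z : j ∈ Z
      j∈Z = ∈-++⁻ʳ {p = R} (subst (_∈ R ++ Z) edge≡ (Circuitⁱ.edges-in C p))

    new-edge-at-v : ∀ w {a b} → Joinsᵉ (h (r ↑ʳ w)) a b → (a ≡ v × b ≢ v) ⊎ (b ≡ v × a ≢ v)
    new-edge-at-v w J with ↑view t t w
    ... | ↑ˡ-view c = at-v (subst (λ e → Joinsᵉ e _ _) (h-vxʰ c) J)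
      where
      at-v : ∀ {a b} → Joinsᵉ vx a b → (a ≡ v × b ≢ v) ⊎ (b ≡ v × a ≢ v)
      at-v (inj₁ (refl , refl)) = inj₁ (refl , fromℕ≢inject₁ ∘ sym)
      at-v (inj₂ (refl , refl)) = inj₂ (refl , fromℕ≢inject₁ ∘ sym)
    ... | ↑ʳ-view c = at-v (subst (λ e → Joinsᵉ e _ _) (h-vyʰ c) J)
      where
      at-v : ∀ {a b} → Joinsᵉ vy a b → (a ≡ v × b ≢ v) ⊎ (b ≡ v × a ≢ v)
      at-v (inj₁ (refl , refl)) = inj₁ (refl , fromℕ≢inject₁ ∘ sym)
      at-v (inj₂ (refl , refl)) = inj₂ (refl , fromℕ≢inject₁ ∘ sym)

    rest-edge : ∀ e {a b} → Joinsᵉ (h e) a b → a ≢ v → b ≢ v → Σ[ i ∈ Fin r ] e ≡ restʰ i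
    rest-edge e J a≢v b≢v with ↑ˡ⊎↑ʳ e
    ... | inj₁ on-rest = on-rest
    ... | inj₂ (w , refl) with new-edge-at-v w J
    ...   | inj₁ (a≡v , _) = ⊥-elim (a≢v a≡v)
    ...   | inj₂ (b≡v , _) = ⊥-elim (b≢v b≡v)

    data EdgeAtV (e : Fin (r + (t + t))) (a : Fin (suc n)) : Set where
      vx-edge : ∀ c → e ≡ vxʰ c → a ≡ inject₁ x → EdgeAtV e a
      vy-edge : ∀ c → e ≡ vyʰ c → a ≡ inject₁ y → EdgeAtV e a

    edgeAtV : ∀ e {a} → Joinsᵉ (h e) a v ⊎ Joinsᵉ (h e) v a → a ≢ v → EdgeAtV e a
    edgeAtV e J a≢v with ↑view r (t + t) e
    ... | ↑ˡ-view i = ⊥-elim ([ (λ J → proj₂ (liftEdge-avoids-fromℕ (rest i) (lift≡ J)) refl)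
                                     , (λ J → proj₁ (liftEdge-avoids-fromℕ (rest i) (lift≡ J)) refl) ]′ J)
      where
      lift≡ : ∀ {a b} → Joinsᵉ (h (restʰ i)) a b → Joinsᵉ (liftEdge (rest i)) a b
      lift≡ = subst (λ e → Joinsᵉ e _ _) (h-restʰ i)
    ... | ↑ʳ-view w with ↑view t t w
    ...   | ↑ˡ-view c = vx-edge c refl (other-end (subst (λ e → Joinsᵉ e _ _ ⊎ Joinsᵉ e _ _) (h-vxʰ c) J))
      where
      other-end : ∀ {a} → Joinsᵉ vx a v ⊎ Joinsᵉ vx v a → a ≡ inject₁ x
      other-end (inj₁ (inj₁ (_ , q))) = ⊥-elim (fromℕ≢inject₁ (sym q))
      other-end (inj₁ (inj₂ (_ , refl))) = refl
      other-end (inj₂ (inj₁ (_ , refl))) = refl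
      other-end (inj₂ (inj₂ (_ , q))) = ⊥-elim (fromℕ≢inject₁ (sym q))
    ...   | ↑ʳ-view c = vy-edge c refl (other-end (subst (λ e → Joinsᵉ e _ _ ⊎ Joinsᵉ e _ _) (h-vyʰ c) J))
      where
      other-end : ∀ {a} → Joinsᵉ vy a v ⊎ Joinsᵉ vy v a → a ≡ inject₁ y
      other-end (inj₁ (inj₁ (_ , q))) = ⊥-elim (fromℕ≢inject₁ (sym q))
      other-end (inj₁ (inj₂ (_ , refl))) = refl
      other-end (inj₂ (inj₁ (_ , refl))) = refl
      other-end (inj₂ (inj₂ (_ , q))) = ⊥-elim (fromℕ≢inject₁ (sym q))

    -- After rotation v is the last vertex; its two circuit edges go to x and to y (two edges to
    -- the same end would be parallel), and they are replaced by one edge of the multiedge.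
    module Shortcut {k} (verts : Fin (suc (suc k)) → Fin (suc n)) (edges : Fin (suc (suc k)) → Fin (r + (t + t)))
      (verts-inj : Injective _≡_ _≡_ verts) (edges-inj : Injective _≡_ _≡_ edges)
      (edges-in : ∀ i → edges i ∈ R ++ (X ++ Y)) (joins : ∀ i → Joinsᵉ (h (edges i)) (verts i) (verts (next i)))
      (neg : parity (signᵉ ∘ h ∘ edges) ≡ true) (last≡v : verts (fromℕ (suc k)) ≡ v) where

      C : Circuitⁱ h (R ++ (X ++ Y))
      C = record { k = suc k ; verts = verts ; edges = edges ; verts-inj = verts-inj ; edges-inj = edges-inj
                 ; edges-in = edges-in ; joins = joins }

      L α : Fin (suc (suc k))
      L = fromℕ (suc k)
      α = inject₁ (fromℕ k)

      pos : Fin k → Fin (suc (suc k))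
      pos q = inject₁ (inject₁ q)

      avoids-v : ∀ i → i ≢ L → verts i ≢ v
      avoids-v i i≢L eq = i≢L (verts-inj (trans eq (sym last≡v)))

      inject₁≢L : ∀ (i : Fin (suc k)) → inject₁ i ≢ L
      inject₁≢L i eq = fromℕ≢inject₁ (sym eq)

      α-joins : Joinsᵉ (h (edges α)) (verts α) v
      α-joins = subst (Joinsᵉ (h (edges α)) (verts α)) (trans (cong verts (next-inject₁ (fromℕ k))) last≡v) (joins α)

      L-joins : Joinsᵉ (h (edges L)) v (verts zero)
      L-joins = subst₂ (Joinsᵉ (h (edges L))) last≡v (cong verts (next-fromℕ (suc k))) (joins L)

      others-rest : ∀ q → Σ[ i ∈ Fin r ] edges (pos q) ≡ restʰ i
      others-rest q = rest-edge (edges (pos q)) (joins (pos q)) (avoids-v (pos q) (inject₁≢L (inject₁ q)))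
        (subst (_≢ v) (cong verts (sym (next-inject₁ (inject₁ q)))) (avoids-v (inject₁ (suc q)) (inject₁≢L (suc q))))

      ix : Fin k → Fin r
      ix q = proj₁ (others-rest q)

      verts′ : Fin (suc k) → Fin n
      verts′ i = lower (verts (inject₁ i)) (avoids-v (inject₁ i) (inject₁≢L i))

      verts′≡ : ∀ i → inject₁ (verts′ i) ≡ verts (inject₁ i)
      verts′≡ i = inject₁-lower (verts (inject₁ i)) (avoids-v (inject₁ i) (inject₁≢L i))

      parity-others : (parity (signᵉ ∘ h ∘ edges ∘ pos) xor signᵉ (h (edges α))) xor signᵉ (h (edges L)) ≡ true
      parity-others = trans (cong (_xor signᵉ (h (edges L))) (sym (parity-init-last (signᵉ ∘ h ∘ edges ∘ inject₁))))
                            (trans (sym (parity-init-last (signᵉ ∘ h ∘ edges))) neg)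

      module Via (z : Fin t) (z∈Z : z ∈ Z) (J : Joinsᵉ xy (verts′ (fromℕ k)) (verts′ zero))
                 (σαL : signᵉ (h (edges α)) xor signᵉ (h (edges L)) ≡ s) where

        restEdges : Fin k → Fin (r + t)
        restEdges = restᵍ ∘ ix

        edges′ : Fin (suc k) → Fin (r + t)
        edges′ = snoc restEdges (xyᵍ z)

        rest-injective : Injective _≡_ _≡_ restEdges
        rest-injective {q} {q′} eq = inject₁-injective (inject₁-injective (edges-inj (trans (proj₂ (others-rest q))
          (trans (cong restʰ (Fin.↑ˡ-injective t _ _ eq)) (sym (proj₂ (others-rest q′)))))))

        rest-∈ : ∀ q → restEdges q ∈ R ++ Z
        rest-∈ q = ∈-++⁺ˡ {q = Z} (∈-++⁻ˡ {p = R} {q = X ++ Y} (subst (_∈ R ++ (X ++ Y)) (proj₂ (others-rest q)) (edges-in (pos q))))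

        rest≡ : ∀ q → h (edges (pos q)) ≡ liftEdge (g (restEdges q))
        rest≡ q = trans (cong h (proj₂ (others-rest q))) (trans (h-restʰ (ix q)) (cong liftEdge (sym (g-restᵍ (ix q)))))

        joins′ : ∀ i → Joinsᵉ (g (edges′ i)) (verts′ i) (verts′ (next i))
        joins′ i with injectOrLast i
        ... | fromℕ-view = subst₂ (λ e w → Joinsᵉ (g e) (verts′ (fromℕ k)) w)
                (sym (snoc-fromℕ restEdges (xyᵍ z))) (cong verts′ (sym (next-fromℕ k)))
                (subst (λ e → Joinsᵉ e _ _) (sym (g-xyᵍ z)) J)
        ... | inject₁-view q = subst₂ (λ e w → Joinsᵉ (g e) (verts′ (inject₁ q)) w)
                (sym (snoc-inject₁ restEdges (xyᵍ z) q)) (cong verts′ (sym (next-inject₁ q)))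
                (Joinsᵉ-unlift (g (restEdges q))
                  (subst₂ (Joinsᵉ (liftEdge (g (restEdges q)))) (sym (verts′≡ (inject₁ q)))
                     (trans (cong verts (next-inject₁ (inject₁ q))) (sym (verts′≡ (suc q))))
                     (subst (λ e → Joinsᵉ e _ _) (rest≡ q) (joins (pos q)))))

        circuit : Circuitⁱ g (R ++ Z)
        circuit = record
          { k = k ; verts = verts′ ; edges = edges′
          ; verts-inj = λ {i} {j} eq → inject₁-injective (verts-inj (trans (sym (verts′≡ i)) (trans (cong inject₁ eq) (verts′≡ j))))
          ; edges-inj = snoc-injective rest-injective (λ q → ↑ˡ≢↑ʳ (ix q) z)
          ; edges-in  = snoc-all (_∈ R ++ Z) rest-∈ (∈-++⁺ʳ {p = R} z∈Z)
          ; joins     = joins′ }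

        negative : Negativeⁱ circuit
        negative = begin
          parity (σ ∘ edges′)                                    ≡⟨ parity-cong (∘-snoc σ restEdges (xyᵍ z)) ⟩
          parity (snoc (σ ∘ restEdges) (σ (xyᵍ z)))              ≡⟨ parity-snoc (σ ∘ restEdges) (σ (xyᵍ z)) ⟩
          parity (σ ∘ restEdges) xor σ (xyᵍ z)                   ≡⟨ cong₂ _xor_ (parity-cong (λ q → cong signᵉ (sym (rest≡ q))))
                                                                                (trans (cong signᵉ (g-xyᵍ z)) (sym σαL)) ⟩
          parity (σʰ ∘ pos) xor (σʰ α xor σʰ L)                  ≡⟨ xor-assoc (parity (σʰ ∘ pos)) _ _ ⟨
          (parity (σʰ ∘ pos) xor σʰ α) xor σʰ L                  ≡⟨ parity-others ⟩
          true                                                   ∎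
          where
          open ≡-Reasoning
          σ : Fin (r + t) → Bool
          σ = signᵉ ∘ g
          σʰ : Fin (suc (suc k)) → Bool
          σʰ = signᵉ ∘ h ∘ edges

        result : NegativeCircuitⁱ g (R ++ Z)
        result = circuit , negative

      ≈vx : ∀ {i c} → edges i ≡ vxʰ c → h (edges i) ≈ᵉ vx
      ≈vx {c = c} eq = subst (_≈ᵉ vx) (sym (trans (cong h eq) (h-vxʰ c))) (≈ᵉ-refl vx)

      ≈vy : ∀ {i c} → edges i ≡ vyʰ c → h (edges i) ≈ᵉ vy
      ≈vy {c = c} eq = subst (_≈ᵉ vy) (sym (trans (cong h eq) (h-vyʰ c))) (≈ᵉ-refl vy)

      α≢L : α ≢ L
      α≢L = inject₁≢L (fromℕ k)

      refute-positive : parity (signᵉ ∘ h ∘ edges) ≡ false → NegativeCircuitⁱ g (R ++ Z)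
      refute-positive pos≡ = ⊥-elim (true≢false (trans (sym neg) pos≡))

      lowered : ∀ {i a} → verts (inject₁ i) ≡ inject₁ a → verts′ i ≡ a
      lowered {i} eq = inject₁-injective (trans (verts′≡ i) eq)

      ∈X : ∀ {i c} → edges i ≡ vxʰ c → c ∈ X
      ∈X {i} eq = ∈-++⁻ˡ {q = Y} (∈-++⁻ʳ {p = R} (subst (_∈ R ++ (X ++ Y)) eq (edges-in i)))

      ∈Y : ∀ {i c} → edges i ≡ vyʰ c → c ∈ Y
      ∈Y {i} eq = ∈-++⁻ʳ {p = X} (∈-++⁻ʳ {p = R} (subst (_∈ R ++ (X ++ Y)) eq (edges-in i)))

      sign-vx : ∀ {i c} → edges i ≡ vxʰ c → signᵉ (h (edges i)) ≡ false
      sign-vx = ≈ᵉ-sign ∘ ≈vx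

      sign-vy : ∀ {i c} → edges i ≡ vyʰ c → signᵉ (h (edges i)) ≡ s
      sign-vy = ≈ᵉ-sign ∘ ≈vy

      result : (Nonempty X → Nonempty Y → Nonempty Z) → NegativeCircuitⁱ g (R ++ Z)
      result hyp with edgeAtV (edges α) (inj₁ α-joins) (avoids-v α α≢L)
                    | edgeAtV (edges L) (inj₂ L-joins) (avoids-v zero λ ())
      ... | vx-edge c eq _ | vx-edge c′ eq′ _ = refute-positive (parallel⇒positive C α≢L (≈vx eq) (≈vx eq′))
      ... | vy-edge c eq _ | vy-edge c′ eq′ _ = refute-positive (parallel⇒positive C α≢L (≈vy eq) (≈vy eq′))
      ... | vx-edge c eq α≡x | vy-edge c′ eq′ 0≡y =
        let (z , z∈Z) = hyp (c , ∈X eq) (c′ , ∈Y eq′) in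
        Via.result z z∈Z (inj₁ (sym (lowered α≡x) , sym (lowered 0≡y)))
          (cong₂ _xor_ (sign-vx eq) (sign-vy eq′))
      ... | vy-edge c eq α≡y | vx-edge c′ eq′ 0≡x =
        let (z , z∈Z) = hyp (c′ , ∈X eq′) (c , ∈Y eq) in
        Via.result z z∈Z (inj₂ (sym (lowered 0≡x) , sym (lowered α≡y)))
          (trans (cong₂ _xor_ (sign-vy eq) (sign-vx eq′)) (xor-identityʳ s))

    no-loop-at-v : ∀ e → ¬ Joinsᵉ (h e) v v
    no-loop-at-v e J with ↑view r (t + t) e
    ... | ↑ˡ-view i = proj₁ (liftEdge-avoids-fromℕ (rest i) (subst (λ e → Joinsᵉ e v v) (h-restʰ i) J)) refl
    ... | ↑ʳ-view w with new-edge-at-v w J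
    ...   | inj₁ (_ , v≢v) = v≢v refl
    ...   | inj₂ (_ , v≢v) = v≢v refl

    shortcut : (C : Circuitⁱ h (R ++ (X ++ Y))) → Negativeⁱ C →
      Circuitⁱ.verts C (fromℕ (Circuitⁱ.k C)) ≡ v → (Nonempty X → Nonempty Y → Nonempty Z) →
      NegativeCircuitⁱ g (R ++ Z)
    shortcut record { k = zero ; edges = edges ; joins = joins } _ last≡v _ =
      ⊥-elim (no-loop-at-v (edges zero) (subst₂ (Joinsᵉ (h (edges zero))) last≡v last≡v (joins zero)))
    shortcut record { k = suc k ; verts = verts ; edges = edges ; verts-inj = verts-inj ; edges-inj = edges-inj
                    ; edges-in = edges-in ; joins = joins } neg last≡v =
      Shortcut.result verts edges verts-inj edges-inj edges-in joins neg last≡v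

    negative-h⇒g : (Nonempty X → Nonempty Y → Nonempty Z) →
      NegativeCircuitⁱ h (R ++ (X ++ Y)) → NegativeCircuitⁱ g (R ++ Z)
    negative-h⇒g hyp (C , neg) with Fin.any? (λ p → Circuitⁱ.verts C p Fin.≟ v)
    ... | no avoids = negativeCircuit-embed {S₁ = R} restᵍ (Fin.↑ˡ-injective t _ _)
            (λ i → subst (_≈ᵉ _) (sym (g-restᵍ i)) (≈ᵉ-refl _)) (∈-++⁺ˡ {q = Z})
            (unliftCircuit (restrictˡ {Z = X ++ Y} C on-rest neg))
      where
      open Circuitⁱ C
      on-rest : ∀ p → Σ[ i ∈ Fin r ] edges p ≡ restʰ i
      on-rest p = rest-edge (edges p) (joins p) (λ eq → avoids (p , eq)) (λ eq → avoids (next p , eq))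
    ... | yes (p , vp≡v) = shortcut (rotate c C) (rotate-negative c C neg)
                             (trans (cong (Circuitⁱ.verts C) (next^-fromℕ p)) vp≡v) hyp
      where c = suc (toℕ p)

  balanced-g⇒h : ∀ R Z X Y → (Nonempty X → Nonempty Y → Nonempty Z) →
    Balancedⁱ g (R ++ Z) → Balancedⁱ h (R ++ (X ++ Y))
  balanced-g⇒h R Z X Y hyp bal = bal ∘ negative-h⇒g R Z X Y hyp

  balanced-h⇒g : ∀ R Z X Y → (Nonempty Z → Nonempty X × Nonempty Y) →
    Balancedⁱ h (R ++ (X ++ Y)) → Balancedⁱ g (R ++ Z)
  balanced-h⇒g R Z X Y hyp bal = bal ∘ negative-g⇒h R Z X Y hyp

  -- Balancing deletions translate between g and h without growing: deleting all of Z corresponds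
  -- to deleting the smaller of X and Y.
  module Deletions (R : Subset r) (Z X Y : Subset t) (∣Z∣≡ : ∣ Z ∣ ≡ ∣ X ∣ ⊓ ∣ Y ∣) where

    delete-g⇒h : ∀ F₁ F₂ WX WY → F₁ ⊆ R → WX ⊆ X → WY ⊆ Y → ∣ WX ∣ + ∣ WY ∣ ≤ ∣ F₂ ∣ →
      (Nonempty (X ─ WX) → Nonempty (Y ─ WY) → Nonempty (Z ─ F₂)) → Balancedⁱ g ((R ++ Z) ─ (F₁ ++ F₂)) →
      Σ[ F′ ∈ Subset (r + (t + t)) ] F′ ⊆ R ++ (X ++ Y) × ∣ F′ ∣ ≤ ∣ F₁ ++ F₂ ∣ × Balancedⁱ h ((R ++ (X ++ Y)) ─ F′)
    delete-g⇒h F₁ F₂ WX WY F₁⊆ WX⊆ WY⊆ ∣W∣≤ hyp bal =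
      F₁ ++ (WX ++ WY) , ++⁺-⊆ F₁⊆ (++⁺-⊆ WX⊆ WY⊆) ,
      subst₂ _≤_ (sym (∣++₃∣ F₁ WX WY)) (sym (∣++∣ F₁ F₂)) (ℕ.+-monoʳ-≤ ∣ F₁ ∣ ∣W∣≤) ,
      subst (Balancedⁱ h) (sym (─-++₃ R F₁ X WX Y WY))
        (balanced-g⇒h (R ─ F₁) (Z ─ F₂) (X ─ WX) (Y ─ WY) hyp (subst (Balancedⁱ g) (─-++ R F₁ Z F₂) bal))

    delete-h⇒g : ∀ F₁ FX FY W → F₁ ⊆ R → W ⊆ Z → ∣ W ∣ ≤ ∣ FX ∣ + ∣ FY ∣ →
      (Nonempty (Z ─ W) → Nonempty (X ─ FX) × Nonempty (Y ─ FY)) → Balancedⁱ h ((R ++ (X ++ Y)) ─ (F₁ ++ (FX ++ FY))) →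
      Σ[ F ∈ Subset (r + t) ] F ⊆ R ++ Z × ∣ F ∣ ≤ ∣ F₁ ++ (FX ++ FY) ∣ × Balancedⁱ g ((R ++ Z) ─ F)
    delete-h⇒g F₁ FX FY W F₁⊆ W⊆ ∣W∣≤ hyp bal =
      F₁ ++ W , ++⁺-⊆ F₁⊆ W⊆ ,
      subst₂ _≤_ (sym (∣++∣ F₁ W)) (sym (∣++₃∣ F₁ FX FY)) (ℕ.+-monoʳ-≤ ∣ F₁ ∣ ∣W∣≤) ,
      subst (Balancedⁱ g) (sym (─-++ R F₁ Z W))
        (balanced-h⇒g (R ─ F₁) (Z ─ W) (X ─ FX) (Y ─ FY) hyp (subst (Balancedⁱ h) (─-++₃ R F₁ X FX Y FY) bal))

    ∣⊥∣+∣⊥∣≤ : ∀ k → ∣ ⊥ {t} ∣ + ∣ ⊥ {t} ∣ ≤ k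
    ∣⊥∣+∣⊥∣≤ k = subst (_≤ k) (sym (cong₂ _+_ (∣⊥∣≡0 t) (∣⊥∣≡0 t))) z≤n

    simulate-g⇒h : Simulates (Balancedⁱ g) (R ++ Z) (Balancedⁱ h) (R ++ (X ++ Y))
    simulate-g⇒h F F⊆ bal with Vec.splitAt r F
    ... | F₁ , F₂ , refl with nonempty? (Z ─ F₂)
    ...   | yes survivor = delete-g⇒h F₁ F₂ ⊥ ⊥ (++⁻ˡ-⊆ F⊆) ⊥⊆ ⊥⊆ (∣⊥∣+∣⊥∣≤ _) (λ _ _ → survivor) bal
    ...   | no  none with ℕ.≤-total ∣ X ∣ ∣ Y ∣
    ...     | inj₁ X≤Y = delete-g⇒h F₁ F₂ X ⊥ (++⁻ˡ-⊆ F⊆) ⊆-refl ⊥⊆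
                (subst (_≤ ∣ F₂ ∣) (trans ∣Z∣≡ (trans (ℕ.m≤n⇒m⊓n≡m X≤Y)
                                         (sym (trans (cong (∣ X ∣ +_) (∣⊥∣≡0 t)) (ℕ.+-identityʳ _)))))
                       (p⊆q⇒∣p∣≤∣q∣ (Empty-─⇒⊆ none)))
                (λ X─X _ → ⊥-elim (Empty-p─p X X─X)) bal
    ...     | inj₂ Y≤X = delete-g⇒h F₁ F₂ ⊥ Y (++⁻ˡ-⊆ F⊆) ⊥⊆ ⊆-refl
                (subst (_≤ ∣ F₂ ∣) (trans ∣Z∣≡ (trans (ℕ.m≥n⇒m⊓n≡n Y≤X) (sym (cong (_+ ∣ Y ∣) (∣⊥∣≡0 t)))))
                       (p⊆q⇒∣p∣≤∣q∣ (Empty-─⇒⊆ none)))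
                (λ _ Y─Y → ⊥-elim (Empty-p─p Y Y─Y)) bal

    simulate-h⇒g : Simulates (Balancedⁱ h) (R ++ (X ++ Y)) (Balancedⁱ g) (R ++ Z)
    simulate-h⇒g F F⊆ bal with Vec.splitAt r F
    ... | F₁ , F₂ , refl with Vec.splitAt t F₂
    ...   | FX , FY , refl with nonempty? (X ─ FX) | nonempty? (Y ─ FY)
    ...     | yes X-survivor | yes Y-survivor =
                delete-h⇒g F₁ FX FY ⊥ (++⁻ˡ-⊆ F⊆) ⊥⊆ (subst (_≤ ∣ FX ∣ + ∣ FY ∣) (sym (∣⊥∣≡0 t)) z≤n)
                  (λ _ → X-survivor , Y-survivor) bal
    ...     | no X-none | _ =
                delete-h⇒g F₁ FX FY Z (++⁻ˡ-⊆ F⊆) ⊆-refl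
                  (ℕ.≤-trans (subst (_≤ ∣ X ∣) (sym ∣Z∣≡) (ℕ.m⊓n≤m _ _))
                    (ℕ.≤-trans (p⊆q⇒∣p∣≤∣q∣ (Empty-─⇒⊆ X-none)) (ℕ.m≤m+n _ _)))
                  (λ Z─Z → ⊥-elim (Empty-p─p Z Z─Z)) bal
    ...     | yes _ | no Y-none =
                delete-h⇒g F₁ FX FY Z (++⁻ˡ-⊆ F⊆) ⊆-refl
                  (ℕ.≤-trans (subst (_≤ ∣ Y ∣) (sym ∣Z∣≡) (ℕ.m⊓n≤n _ _))
                    (ℕ.≤-trans (p⊆q⇒∣p∣≤∣q∣ (Empty-─⇒⊆ Y-none)) (ℕ.m≤n+m _ _)))
                  (λ Z─Z → ⊥-elim (Empty-p─p Z Z─Z)) bal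

    frustrationIndex-g⇒h : ∀ l → IsFrustrationIndex (Balancedⁱ g) (R ++ Z) l → IsFrustrationIndex (Balancedⁱ h) (R ++ (X ++ Y)) l
    frustrationIndex-g⇒h = Simulates⇒frustrationIndex {B = Balancedⁱ g} {B′ = Balancedⁱ h} simulate-g⇒h simulate-h⇒g

    frustrationIndex-h⇒g : ∀ l → IsFrustrationIndex (Balancedⁱ h) (R ++ (X ++ Y)) l → IsFrustrationIndex (Balancedⁱ g) (R ++ Z) l
    frustrationIndex-h⇒g = Simulates⇒frustrationIndex {B = Balancedⁱ h} {B′ = Balancedⁱ g} simulate-h⇒g simulate-g⇒h

  FIᵍ : Subset (r + t) → ℕ → Set
  FIᵍ = IsFrustrationIndex (Balancedⁱ g)

  FIʰ : Subset (r + (t + t)) → ℕ → Set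
  FIʰ = IsFrustrationIndex (Balancedⁱ h)

  critical-g⇒h : ∀ R Z {k} → IsCritical (Balancedⁱ g) (R ++ Z) k → IsCritical (Balancedⁱ h) (R ++ (Z ++ Z)) k
  critical-g⇒h R Z = critical-transfer (Balancedⁱ g) (Balancedⁱ h)
    (Deletions.frustrationIndex-g⇒h R Z Z Z (sym (ℕ.⊓-idem _))) minus
    where
    minus : ∀ (e′ : Fin (r + (t + t))) → e′ ∈ R ++ (Z ++ Z) →
      Σ[ e ∈ Fin (r + t) ] e ∈ R ++ Z × (∀ l → FIᵍ ((R ++ Z) - e) l → FIʰ ((R ++ (Z ++ Z)) - e′) l)
    minus e′ e′∈ with ↑view r (t + t) e′
    ... | ↑ˡ-view i = restᵍ i , ∈-++⁺ˡ {q = Z} (∈-++⁻ˡ {q = Z ++ Z} e′∈) , λ l →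
      subst (λ S → FIʰ S l) (sym (++--↑ˡ R (Z ++ Z) i))
      ∘ Deletions.frustrationIndex-g⇒h (R - i) Z Z Z (sym (ℕ.⊓-idem _)) l
      ∘ subst (λ S → FIᵍ S l) (++--↑ˡ R Z i)
    ... | ↑ʳ-view w with ↑view t t w
    ...   | ↑ˡ-view a = xyᵍ a , ∈-++⁺ʳ {p = R} (∈-++⁻ˡ {p = Z} {q = Z} (∈-++⁻ʳ {p = R} e′∈)) , λ l →
      subst (λ S → FIʰ S l) (sym (trans (++--↑ʳ R (Z ++ Z) (a ↑ˡ t)) (cong (R ++_) (++--↑ˡ Z Z a))))
      ∘ Deletions.frustrationIndex-g⇒h R (Z - a) (Z - a) Z (sym (ℕ.m≤n⇒m⊓n≡m (∣p-x∣≤∣p∣ Z a))) l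
      ∘ subst (λ S → FIᵍ S l) (++--↑ʳ R Z a)
    ...   | ↑ʳ-view b = xyᵍ b , ∈-++⁺ʳ {p = R} (∈-++⁻ʳ {p = Z} (∈-++⁻ʳ {p = R} e′∈)) , λ l →
      subst (λ S → FIʰ S l) (sym (trans (++--↑ʳ R (Z ++ Z) (t ↑ʳ b)) (cong (R ++_) (++--↑ʳ Z Z b))))
      ∘ Deletions.frustrationIndex-g⇒h R (Z - b) Z (Z - b) (sym (ℕ.m≥n⇒m⊓n≡n (∣p-x∣≤∣p∣ Z b))) l
      ∘ subst (λ S → FIᵍ S l) (++--↑ʳ R Z b)

  critical-h⇒g : ∀ R X Y {k} → ∣ X ∣ ≤ ∣ Y ∣ → IsCritical (Balancedⁱ h) (R ++ (X ++ Y)) k → IsCritical (Balancedⁱ g) (R ++ X) k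
  critical-h⇒g R X Y X≤Y = critical-transfer (Balancedⁱ h) (Balancedⁱ g)
    (Deletions.frustrationIndex-h⇒g R X X Y (sym (ℕ.m≤n⇒m⊓n≡m X≤Y))) minus
    where
    minus : ∀ (e : Fin (r + t)) → e ∈ R ++ X →
      Σ[ e′ ∈ Fin (r + (t + t)) ] e′ ∈ R ++ (X ++ Y) × (∀ l → FIʰ ((R ++ (X ++ Y)) - e′) l → FIᵍ ((R ++ X) - e) l)
    minus e e∈ with ↑view r t e
    ... | ↑ˡ-view i = restʰ i , ∈-++⁺ˡ {q = X ++ Y} (∈-++⁻ˡ {q = X} e∈) , λ l →
      subst (λ S → FIᵍ S l) (sym (++--↑ˡ R X i))
      ∘ Deletions.frustrationIndex-h⇒g (R - i) X X Y (sym (ℕ.m≤n⇒m⊓n≡m X≤Y)) l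
      ∘ subst (λ S → FIʰ S l) (++--↑ˡ R (X ++ Y) i)
    ... | ↑ʳ-view j = vxʰ j , ∈-++⁺ʳ {p = R} (∈-++⁺ˡ {q = Y} (∈-++⁻ʳ {p = R} e∈)) , λ l →
      subst (λ S → FIᵍ S l) (sym (++--↑ʳ R X j))
      ∘ Deletions.frustrationIndex-h⇒g R (X - j) (X - j) Y (sym (ℕ.m≤n⇒m⊓n≡m (ℕ.≤-trans (∣p-x∣≤∣p∣ X j) X≤Y))) l
      ∘ subst (λ S → FIʰ S l) (trans (++--↑ʳ R (X ++ Y) (j ↑ˡ t)) (cong (R ++_) (++--↑ˡ X Y j)))

  -- Otherwise deleting an edge of the larger half would leave the frustration index unchanged.
  critical⇒balanced-halves : ∀ R X Y {k} → IsCritical (Balancedⁱ h) (R ++ (X ++ Y)) k → ∣ X ∣ ≡ ∣ Y ∣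
  critical⇒balanced-halves R X Y {k} (_ , fi , minus) with ℕ.<-cmp ∣ X ∣ ∣ Y ∣
  ... | tri≈ _ X≡Y _ = X≡Y
  ... | tri< X<Y _ _ =
    let (b , b∈Y) = 1≤∣p∣⇒Nonempty Y (ℕ.≤-trans (s≤s z≤n) X<Y)
        (l , l<k , fl) = minus (vyʰ b) (∈-++⁺ʳ {p = R} (∈-++⁺ʳ {p = X} b∈Y))
        X≤Y-b = ℕ.≤-pred (subst (suc ∣ X ∣ ≤_) (sym (∣p-x∣+1≡∣p∣ b∈Y)) X<Y)
        fl′ = Deletions.frustrationIndex-h⇒g R X X (Y - b) (sym (ℕ.m≤n⇒m⊓n≡m X≤Y-b)) l
                (subst (λ S → FIʰ S l) (trans (++--↑ʳ R (X ++ Y) (t ↑ʳ b)) (cong (R ++_) (++--↑ʳ X Y b))) fl)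
        fk′ = Deletions.frustrationIndex-h⇒g R X X Y (sym (ℕ.m≤n⇒m⊓n≡m (ℕ.<⇒≤ X<Y))) k fi
    in ⊥-elim (ℕ.<-irrefl (frustrationIndex-unique (Balancedⁱ g) fl′ fk′) l<k)
  ... | tri> _ _ Y<X =
    let (a , a∈X) = 1≤∣p∣⇒Nonempty X (ℕ.≤-trans (s≤s z≤n) Y<X)
        (l , l<k , fl) = minus (vxʰ a) (∈-++⁺ʳ {p = R} (∈-++⁺ˡ {q = Y} a∈X))
        Y≤X-a = ℕ.≤-pred (subst (suc ∣ Y ∣ ≤_) (sym (∣p-x∣+1≡∣p∣ a∈X)) Y<X)
        fl′ = Deletions.frustrationIndex-h⇒g R Y (X - a) Y (sym (ℕ.m≥n⇒m⊓n≡n Y≤X-a)) l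
                (subst (λ S → FIʰ S l) (trans (++--↑ʳ R (X ++ Y) (a ↑ˡ t)) (cong (R ++_) (++--↑ˡ X Y a))) fl)
        fk′ = Deletions.frustrationIndex-h⇒g R Y X Y (sym (ℕ.m≥n⇒m⊓n≡n (ℕ.<⇒≤ Y<X))) k fi
    in ⊥-elim (ℕ.<-irrefl (frustrationIndex-unique (Balancedⁱ g) fl′ fk′) l<k)

  ⊤ᵍ : ⊤ {r + t} ≡ ⊤ {r} ++ ⊤ {t}
  ⊤ᵍ = replicate-++ r t true

  ⊤ʰ : ⊤ {r + (t + t)} ≡ ⊤ {r} ++ (⊤ {t} ++ ⊤ {t})
  ⊤ʰ = trans (replicate-++ r (t + t) true) (cong (⊤ {r} ++_) (replicate-++ t t true))

  frustrationIndex-⊤-g⇒h : ∀ l → FIᵍ ⊤ l → FIʰ ⊤ l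
  frustrationIndex-⊤-g⇒h l = subst (λ S → FIʰ S l) (sym ⊤ʰ)
    ∘ Deletions.frustrationIndex-g⇒h ⊤ ⊤ ⊤ ⊤ (sym (ℕ.⊓-idem _)) l ∘ subst (λ S → FIᵍ S l) ⊤ᵍ

  frustrationIndex-⊤-h⇒g : ∀ l → FIʰ ⊤ l → FIᵍ ⊤ l
  frustrationIndex-⊤-h⇒g l = subst (λ S → FIᵍ S l) (sym ⊤ᵍ)
    ∘ Deletions.frustrationIndex-h⇒g ⊤ ⊤ ⊤ ⊤ (sym (ℕ.⊓-idem _)) l ∘ subst (λ S → FIʰ S l) ⊤ʰ

  critical-⊤-g⇒h : ∀ k → IsCritical (Balancedⁱ g) ⊤ k → IsCritical (Balancedⁱ h) ⊤ k
  critical-⊤-g⇒h k = subst (λ S → IsCritical (Balancedⁱ h) S k) (sym ⊤ʰ)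
    ∘ critical-g⇒h ⊤ ⊤ ∘ subst (λ S → IsCritical (Balancedⁱ g) S k) ⊤ᵍ

  critical-⊤-h⇒g : ∀ k → IsCritical (Balancedⁱ h) ⊤ k → IsCritical (Balancedⁱ g) ⊤ k
  critical-⊤-h⇒g k = subst (λ S → IsCritical (Balancedⁱ g) S k) (sym ⊤ᵍ)
    ∘ critical-h⇒g ⊤ ⊤ ⊤ ℕ.≤-refl ∘ subst (λ S → IsCritical (Balancedⁱ h) S k) ⊤ʰ

  decomposable-g⇒h : IsDecomposable (Balancedⁱ g) → IsDecomposable (Balancedⁱ h)
  decomposable-g⇒h (k , crit , c , 2≤c , ks , 1≤ks , sum≡k , Hs , disjoint , crits) =
    k , critical-⊤-g⇒h k crit , c , 2≤c , ks , 1≤ks , sum≡k , Hs′ ,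
    (λ i j i≢j → let (R∩ , Z∩) = ++-disjoint⁻ (Rs i) (Rs j) (disjoint′ i j i≢j)
                 in ++-disjoint⁺ R∩ (++-disjoint⁺ Z∩ Z∩)) ,
    λ i → critical-g⇒h (Rs i) (Zs i) (subst (λ S → IsCritical (Balancedⁱ g) S (ks i)) (split≡ i) (crits i))
    where
    Rs : Fin c → Subset r
    Rs i = proj₁ (Vec.splitAt r (Hs i))
    Zs : Fin c → Subset t
    Zs i = proj₁ (proj₂ (Vec.splitAt r (Hs i)))
    split≡ : ∀ i → Hs i ≡ Rs i ++ Zs i
    split≡ i = proj₂ (proj₂ (Vec.splitAt r (Hs i)))
    disjoint′ : ∀ i j → i ≢ j → (Rs i ++ Zs i) ∩ (Rs j ++ Zs j) ≡ ⊥
    disjoint′ i j = subst₂ (λ H H′ → H ∩ H′ ≡ ⊥) (split≡ i) (split≡ j) ∘ disjoint i j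
    Hs′ : Fin c → Subset (r + (t + t))
    Hs′ i = Rs i ++ (Zs i ++ Zs i)

  decomposable-h⇒g : IsDecomposable (Balancedⁱ h) → IsDecomposable (Balancedⁱ g)
  decomposable-h⇒g (k , crit , c , 2≤c , ks , 1≤ks , sum≡k , Hs , disjoint , crits) =
    k , critical-⊤-h⇒g k crit , c , 2≤c , ks , 1≤ks , sum≡k , Hs′ ,
    (λ i j i≢j → let (R∩ , XY∩) = ++-disjoint⁻ (Rs i) (Rs j) (disjoint′ i j i≢j)
                 in ++-disjoint⁺ R∩ (proj₁ (++-disjoint⁻ (Xs i) (Xs j) XY∩))) ,
    λ i → let crit-i = subst (λ S → IsCritical (Balancedⁱ h) S (ks i)) (split≡ i) (crits i) in
          critical-h⇒g (Rs i) (Xs i) (Ys i) (ℕ.≤-reflexive (critical⇒balanced-halves (Rs i) (Xs i) (Ys i) crit-i)) crit-i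
    where
    Rs : Fin c → Subset r
    Rs i = proj₁ (Vec.splitAt r (Hs i))
    Xs Ys : Fin c → Subset t
    Xs i = proj₁ (Vec.splitAt t (proj₁ (proj₂ (Vec.splitAt r (Hs i)))))
    Ys i = proj₁ (proj₂ (Vec.splitAt t (proj₁ (proj₂ (Vec.splitAt r (Hs i))))))
    split≡ : ∀ i → Hs i ≡ Rs i ++ (Xs i ++ Ys i)
    split≡ i = trans (proj₂ (proj₂ (Vec.splitAt r (Hs i))))
                     (cong (Rs i ++_) (proj₂ (proj₂ (Vec.splitAt t (proj₁ (proj₂ (Vec.splitAt r (Hs i))))))))
    disjoint′ : ∀ i j → i ≢ j → (Rs i ++ (Xs i ++ Ys i)) ∩ (Rs j ++ (Xs j ++ Ys j)) ≡ ⊥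
    disjoint′ i j = subst₂ (λ H H′ → H ∩ H′ ≡ ⊥) (split≡ i) (split≡ j) ∘ disjoint i j
    Hs′ : Fin c → Subset (r + t)
    Hs′ i = Rs i ++ Xs i

  equivalent : ∀ {k} → Equivalent (Balancedⁱ g) (Balancedⁱ h) k
  equivalent {k} = mkEquivalent (λ l → mk⇔ (frustrationIndex-⊤-g⇒h l) (frustrationIndex-⊤-h⇒g l))
                   (mk⇔ (critical-⊤-g⇒h k) (critical-⊤-h⇒g k)) (mk⇔ decomposable-g⇒h decomposable-h⇒g)

list-equivalent : ∀ {n m} {G : SignedGraph n} {g : IndexedGraph n m} {k} →
  List.lookup G ≅ g → Equivalent (Balanced G) (Balancedⁱ g) k
list-equivalent {G = G} G≅g = relabel-equivalent (_≅_.relabel G≅g)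
  (λ S → ≅-balanced G≅g S ∘ balanced⇒balancedⁱ G)
  (λ S′ → balancedⁱ⇒balanced G ∘ ≅-balanced (≅-sym G≅g) S′)

All-≈ᵉ : ∀ {n} {x y : Fin n} {s} {ms : SignedGraph n} → All (λ e → e ≡ (x , y , s) ⊎ e ≡ (y , x , s)) ms →
  ∀ i → List.lookup ms i ≈ᵉ (x , y , s)
All-≈ᵉ (inj₁ refl ∷ _) zero    = inj₁ (refl , refl) , refl
All-≈ᵉ (inj₂ refl ∷ _) zero    = inj₂ (refl , refl) , refl
All-≈ᵉ (_ ∷ all)       (suc i) = All-≈ᵉ all i

subdivisionStep-equivalent : ∀ {n} {G : SignedGraph n} {H : SignedGraph (suc n)} {k} →
  SubdivisionStep G H → Equivalent (Balanced G) (Balanced H) k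
subdivisionStep-equivalent {n} {G} {H} {k} (x , y , s , rest , ms , _ , ms≈ , G↭ , H↭) =
  Equivalent-trans G∼g (Equivalent-trans g∼h h∼H)
  where
  t = List.length ms
  open Subdivide {t = t} (List.lookup rest) x y s using (xy; vx; vy; g; h; equivalent)
  G≅g : List.lookup G ≅ g
  G≅g = ≅-trans (↭⇒≅ G↭) (≅-trans (++⇒≅ rest ms) (≅-++ᶠ ≅-refl (≅-const Perm.id (All-≈ᵉ ms≈))))
  H≅h : List.lookup H ≅ h
  H≅h = ≅-trans (↭⇒≅ H↭) (≅-trans (++⇒≅ (List.map liftEdge rest) (List.replicate t vx List.++ List.replicate t vy))
          (≅-++ᶠ (map⇒≅ liftEdge rest)
            (≅-trans (++⇒≅ (List.replicate t vx) (List.replicate t vy)) (≅-++ᶠ (replicate⇒≅ t vx) (replicate⇒≅ t vy)))))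
  G∼g : Equivalent (Balanced G) (Balancedⁱ g) k
  G∼g = list-equivalent G≅g
  g∼h : Equivalent (Balancedⁱ g) (Balancedⁱ h) k
  g∼h = equivalent
  h∼H : Equivalent (Balancedⁱ h) (Balanced H) k
  h∼H = Equivalent-sym (list-equivalent H≅h)

subdivision-equivalent : ∀ {n m} {G : SignedGraph n} {H : SignedGraph m} {k} →
  Subdivision G H → Equivalent (Balanced G) (Balanced H) k
subdivision-equivalent same          = Equivalent-refl
subdivision-equivalent (step st sub) = Equivalent-trans (subdivisionStep-equivalent st) (subdivision-equivalent sub)

theorem3p2 : (k : ℕ) → 1 ≤ k →
    ∀ {n m} (G : SignedGraph n) (H : SignedGraph m) → Subdivision G H →
    ((l : ℕ) → FrustrationIndex G ⊤ l ⇔ FrustrationIndex H ⊤ l)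
    × (Critical G k ⇔ Critical H k)
    × (Decomposable G ⇔ Decomposable H)
theorem3p2 k _ G H sub = frustrationIndex⇔ , critical⇔ , decomposable⇔
  where open Equivalent (subdivision-equivalent {k = k} sub)
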